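{- For $d$ large, $g(B_d)-p(B_d)=\Theta(|V(B_d)|)$; that is, there are constants $c_1,c_2>0$ and $d_0$ such that $c_1|V(B_d)|\le g(B_d)-p(B_d)\le c_2|V(B_d)|$ for all $d\ge d_0$.
   Context: $B_d$ is the complete binary tree of depth $d$ (a rooted tree with $d+1$ levels in which every non-leaf vertex has exactly two children, all leaves on the last level). $L(X)$ is the line graph of $X$; $pcn(X)$ is the minimum number of vertex-disjoint paths covering all vertices of $X$. $g(G)=pcn(L(G))$, and $p(G)=\min\{pcn(L(G')): G' \text{ a spanning (not necessarily connected) subgraph of } G \text{ with no isolated vertices}\}$. -}

module Defs where

open import Data.Nat using (ℕ; zero; suc; _+_; _*_; _∸_; _^_; _≤_; _<_)
open import Data.Nat.DivMod using (_/_)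
open import Data.Fin using (Fin)
open import Data.List using (List; []; _∷_; [_]; length; lookup; concat; allFin; applyUpTo)
open import Data.List.Relation.Unary.All using (All)
open import Data.List.Relation.Unary.Any using (Any)
open import Data.List.Relation.Binary.Permutation.Propositional using (_↭_)
open import Data.List.Relation.Binary.Sublist.Propositional using (_⊆_)
open import Data.Product using (Σ; _×_; ∃; proj₁; proj₂; _,_)
open import Data.Sum using (_⊎_)
open import Relation.Binary.PropositionalEquality using (_≡_; _≢_)

IsMin : (ℕ → Set) → ℕ → Set
IsMin P n = P n × (∀ k → P k → n ≤ k)

module _ {m : ℕ} (Adj : Fin m → Fin m → Set) where

  data Walk : List (Fin m) → Set where
    single : ∀ v → Walk [ v ]
    step   : ∀ u v vs → Adj u v → Walk (v ∷ vs) → Walk (u ∷ v ∷ vs)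

  -- k vertex-disjoint paths covering all vertices: the concatenation of the
  -- vertex sequences is a permutation of the vertex set (so all vertices are
  -- distinct, i.e. the walks are paths and they are pairwise disjoint).
  HasPathCover : ℕ → Set
  HasPathCover k = Σ (List (List (Fin m))) λ ps →
    (length ps ≡ k) × All Walk ps × (concat ps ↭ allFin m)

  IsPCN : ℕ → Set
  IsPCN = IsMin HasPathCover

Edge : Set
Edge = ℕ × ℕ

ShareEnd : Edge → Edge → Set
ShareEnd e f = (proj₁ e ≡ proj₁ f) ⊎ (proj₁ e ≡ proj₂ f) ⊎ (proj₂ e ≡ proj₁ f) ⊎ (proj₂ e ≡ proj₂ f)

LineAdj : (E : List Edge) → Fin (length E) → Fin (length E) → Set
LineAdj E i j = (i ≢ j) × ShareEnd (lookup E i) (lookup E j)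

-- Complete binary tree B_d, heap-numbered: vertices 0 .. N-1 with
-- N = 2^(d+1) - 1; vertex i+1 has parent i / 2 (so i has children 2i+1, 2i+2).

numV : ℕ → ℕ
numV d = 2 ^ (suc d) ∸ 1

BEdges : ℕ → List Edge
BEdges d = applyUpTo (λ i → (i / 2 , suc i)) (numV d ∸ 1)

IsG : ℕ → ℕ → Set
IsG d = IsPCN (LineAdj (BEdges d))

SpanNoIso : ℕ → List Edge → Set
SpanNoIso d F = (F ⊆ BEdges d) ×
  (∀ v → v < numV d → Any (λ e → (v ≡ proj₁ e) ⊎ (v ≡ proj₂ e)) F)

IsP : ℕ → ℕ → Set
IsP d = IsMin (λ k → Σ (List Edge) λ F → SpanNoIso d F × IsPCN (LineAdj F) k)

-- Number the edges of B_d by their lower endpoints.  A cover of L(B_d) by g paths lists all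
-- E edges in a duplicate-free word with E − g "links", i.e. consecutive edges sharing a vertex.
-- The three edges at an inner vertex form a triangle of L(B_d), which carries at most two links,
-- and every edge lies in at most two links.  A potential on subtrees, whose local step is a
-- finite check, turns these constraints into: links ≤ 43/50 · E + O(1), so g ≥ 7/50 · E − O(1).
-- For p, take every fourth level of the tree (shifted so that the last block ends at the leaves):
-- below each vertex on such a level the 14 edges of depth at most 3 form two paths of 7 edges in
-- the line graph, and the few levels above the first block are covered by single edges.  This
-- spanning subgraph without isolated vertices needs about 2/15 · |V| paths, and 2/15 < 7/50.
-- Finally g ≤ E < |V| by covering L(B_d) with single vertices.

module Submission where

open import Function using (_∘_; _⟨_⟩_; mk⇔)
open import Data.Bool using (Bool; true; false)
import Data.Bool as Bool
open import Data.Nat using (ℕ; zero; suc; _+_; _*_; _∸_; _^_; _≤_; _<_; _⊓_; z≤n; s≤s; _≟_; _≤?_; _<?_; ⌊_/2⌋; NonZero; >-nonZero)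
open import Data.Nat.Properties
open import Data.Nat.DivMod using (_/_; _%_; m≡m%n+[m/n]*n; m%n<n; m/n≡1+[m∸n]/n)
open import Data.Nat.Induction using (<-rec)
open import Data.Nat.ListAction using (sum)
open import Data.Nat.Logarithm using (⌊log₂_⌋; ⌊log₂⌊n/2⌋⌋≡⌊log₂n⌋∸1; ⌊log₂⌋-mono-≤)
open import Data.Nat.Tactic.RingSolver using (solve-∀)
open import Data.Fin using (Fin; toℕ)
open import Data.Fin.Properties using (toℕ<n; toℕ-injective)
open import Data.List using (List; []; _∷_; [_]; _++_; map; length; concat; concatMap; lookup; allFin; upTo; filter)
import Data.List.Properties as List
open import Data.List.Properties using (length-++; length-map; length-tabulate; length-applyUpTo; lookup-applyUpTo; concat-map; concat-concat; concat-map-[_]; concatMap-++; map-∘; map-cong; map-tabulate; tabulate-lookup; ∷-injective; upTo-∷ʳ; ++-identityʳ)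
open import Data.List.Membership.Propositional using (_∈_; _∉_)
open import Data.List.Membership.Propositional.Properties using (∈-map⁻; ∈-map⁺; ∈-concat⁻′; ∈-concat⁺′; ∈-applyUpTo⁺; ∈-upTo⁺; ∈-upTo⁻; ∈-filter⁺; ∈-filter⁻)
open import Data.List.Membership.Propositional.Properties.WithK using (unique∧set⇒bag)
open import Data.List.Relation.Unary.Any as Any using (Any; here; there)
open import Data.List.Relation.Unary.All as All using (All; []; _∷_; all?)
import Data.List.Relation.Unary.All.Properties as All
open import Data.List.Relation.Unary.AllPairs using ([]; _∷_)
import Data.List.Relation.Unary.AllPairs as AllPairs
open import Data.List.Relation.Unary.Linked using (Linked; _∷_; [-])
open import Data.List.Relation.Unary.Linked.Properties using (Linked⇒AllPairs)
open import Data.List.Relation.Unary.Unique.Propositional using (Unique)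
open import Data.List.Relation.Unary.Unique.Propositional.Properties using (map⁺; ++⁺; upTo⁺; allFin⁺; filter⁺; applyUpTo⁺₁)
open import Data.List.Relation.Binary.Permutation.Propositional using (_↭_; ↭-sym; ↭-reflexive; ↭⇒↭ₛ)
open import Data.List.Relation.Binary.Permutation.Propositional.Properties using (shift; ↭-length; ↭-map-inv)
import Data.List.Relation.Binary.Permutation.Setoid.Properties as Perm
open import Data.List.Relation.Binary.BagAndSetEquality using (∼bag⇒↭)
open import Data.List.Relation.Binary.Sublist.Propositional.Properties using (filter-⊆)
open import Data.Product using (Σ; _×_; _,_; proj₁; proj₂)
import Data.Product.Properties as Product
open import Data.Sum using (_⊎_; inj₁; inj₂)
import Data.Sum as Sum
open import Data.Empty using (⊥-elim)
open import Relation.Nullary using (¬_; Dec; yes; no)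
open import Relation.Nullary.Decidable using (_×-dec_; _⊎-dec_; _→-dec_; from-yes; decidable-stable)
open import Relation.Binary.PropositionalEquality hiding ([_])
open import Data.List.Relation.Unary.Unique.DecPropositional (List.≡-dec Bool._≟_) using (unique?)
open import Data.List.Membership.DecPropositional (List.≡-dec Bool._≟_) using () renaming (_∈?_ to _∈ᶜ?_)
open import Data.List.Membership.DecPropositional (Product.≡-dec _≟_ _≟_) using () renaming (_∈?_ to _∈ᵉ?_)
open import Defs

-- Consecutive pairs in a duplicate-free list

𝟙 : ∀ {p} {P : Set p} → Dec P → ℕ
𝟙 (yes _) = 1
𝟙 (no _)  = 0

𝟙≤1 : ∀ {p} {P : Set p} (P? : Dec P) → 𝟙 P? ≤ 1
𝟙≤1 (yes _) = s≤s z≤n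
𝟙≤1 (no _)  = z≤n

𝟙-yes : ∀ {p} {P : Set p} (P? : Dec P) → P → 𝟙 P? ≡ 1
𝟙-yes (yes _) _  = refl
𝟙-yes (no ¬p) p = ⊥-elim (¬p p)

𝟙-no : ∀ {p} {P : Set p} (P? : Dec P) → ¬ P → 𝟙 P? ≡ 0
𝟙-no (yes p) ¬p = ⊥-elim (¬p p)
𝟙-no (no _)  _  = refl

module _ {A : Set} where

  adjSum : (A → A → ℕ) → List A → ℕ
  adjSum f []           = 0
  adjSum f (x ∷ [])     = 0
  adjSum f (x ∷ y ∷ xs) = f x y + adjSum f (y ∷ xs)

  adjSum-+ : ∀ f g xs → adjSum (λ x y → f x y + g x y) xs ≡ adjSum f xs + adjSum g xs
  adjSum-+ f g []           = refl
  adjSum-+ f g (x ∷ [])     = refl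
  adjSum-+ f g (x ∷ y ∷ xs) rewrite adjSum-+ f g (y ∷ xs) =
    +-assoc-comm (f x y) (g x y) (adjSum f (y ∷ xs)) (adjSum g (y ∷ xs))
    where
    +-assoc-comm : ∀ a b c d → a + b + (c + d) ≡ a + c + (b + d)
    +-assoc-comm = solve-∀

  adjSum-mono : ∀ {f g} → (∀ x y → f x y ≤ g x y) → ∀ xs → adjSum f xs ≤ adjSum g xs
  adjSum-mono f≤g []           = z≤n
  adjSum-mono f≤g (x ∷ [])     = z≤n
  adjSum-mono f≤g (x ∷ y ∷ xs) = +-mono-≤ (f≤g x y) (adjSum-mono f≤g (y ∷ xs))

  adjSum-cong : ∀ {f g} → (∀ x y → f x y ≡ g x y) → ∀ xs → adjSum f xs ≡ adjSum g xs
  adjSum-cong f≗g []           = refl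
  adjSum-cong f≗g (x ∷ [])     = refl
  adjSum-cong f≗g (x ∷ y ∷ xs) = cong₂ _+_ (f≗g x y) (adjSum-cong f≗g (y ∷ xs))

  adjSum-zero : ∀ f xs → (∀ {x y} → x ∈ xs → y ∈ xs → f x y ≡ 0) → adjSum f xs ≡ 0
  adjSum-zero f []           _ = refl
  adjSum-zero f (x ∷ [])     _ = refl
  adjSum-zero f (x ∷ y ∷ xs) f≡0 = cong₂ _+_ (f≡0 (here refl) (there (here refl)))
    (adjSum-zero f (y ∷ xs) λ x∈ y∈ → f≡0 (there x∈) (there y∈))

  adjSum-++ : ∀ f xs ys → adjSum f xs + adjSum f ys ≤ adjSum f (xs ++ ys)
  adjSum-++ f []           ys       = ≤-refl
  adjSum-++ f (x ∷ [])     []       = z≤n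
  adjSum-++ f (x ∷ [])     (y ∷ ys) = m≤n+m _ _
  adjSum-++ f (x ∷ y ∷ xs) ys       = begin
    f x y + adjSum f (y ∷ xs) + adjSum f ys   ≡⟨ +-assoc (f x y) _ _ ⟩
    f x y + (adjSum f (y ∷ xs) + adjSum f ys) ≤⟨ +-monoʳ-≤ (f x y) (adjSum-++ f (y ∷ xs) ys) ⟩
    f x y + adjSum f (y ∷ xs ++ ys)           ∎
    where open ≤-Reasoning

adjSum-map : ∀ {A B : Set} (g : A → B) (f : B → B → ℕ) xs →
             adjSum f (map g xs) ≡ adjSum (λ x y → f (g x) (g y)) xs
adjSum-map g f []           = refl
adjSum-map g f (x ∷ [])     = refl
adjSum-map g f (x ∷ y ∷ xs) = cong (f (g x) (g y) +_) (adjSum-map g f (y ∷ xs))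

Joins : ℕ → ℕ → ℕ → ℕ → Set
Joins a b x y = (x ≡ a × y ≡ b) ⊎ (x ≡ b × y ≡ a)

joins? : ∀ a b x y → Dec (Joins a b x y)
joins? a b x y = (x ≟ a ×-dec y ≟ b) ⊎-dec (x ≟ b ×-dec y ≟ a)

joinCount : ℕ → ℕ → ℕ → ℕ → ℕ
joinCount a b x y = 𝟙 (joins? a b x y)

touchCount : ℕ → ℕ → ℕ → ℕ
touchCount a x y = 𝟙 (x ≟ a ⊎-dec y ≟ a)

Joins-sym : ∀ {a b x y} → Joins a b x y → Joins b a x y
Joins-sym (inj₁ p) = inj₂ p
Joins-sym (inj₂ p) = inj₁ p

Joins-touches : ∀ {a b x y} → Joins a b x y → x ≡ a ⊎ y ≡ a
Joins-touches (inj₁ (x≡a , _)) = inj₁ x≡a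
Joins-touches (inj₂ (_ , y≡a)) = inj₂ y≡a

Joins-from : ∀ {a b y} → a ≢ b → Joins a b a y → y ≡ b
Joins-from _   (inj₁ (_ , y≡b)) = y≡b
Joins-from a≢b (inj₂ (a≡b , _)) = ⊥-elim (a≢b a≡b)

joinCount-sym : ∀ a b x y → joinCount a b x y ≡ joinCount b a x y
joinCount-sym a b x y with joins? a b x y | joins? b a x y
... | yes _ | yes _ = refl
... | no  _ | no  _ = refl
... | yes j | no ¬j = ⊥-elim (¬j (Joins-sym j))
... | no ¬j | yes j = ⊥-elim (¬j (Joins-sym j))

joinCount-apart : ∀ {a} b {x y} → x ≢ a → y ≢ a → joinCount a b x y ≡ 0
joinCount-apart b x≢a y≢a = 𝟙-no (joins? _ b _ _) λ j → Sum.[ x≢a , y≢a ] (Joins-touches j)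

adjSum-join-∉ : ∀ a b xs → a ∉ xs → adjSum (joinCount a b) xs ≡ 0
adjSum-join-∉ a b xs a∉ = adjSum-zero _ xs λ x∈ y∈ →
  joinCount-apart b (λ { refl → a∉ x∈ }) (λ { refl → a∉ y∈ })

Unique-head : ∀ {x : ℕ} {xs} → Unique (x ∷ xs) → x ∉ xs
Unique-head (x≢ ∷ _) x∈ = All.lookup x≢ x∈ refl

adjSum-join≤1 : ∀ a b xs → Unique xs → adjSum (joinCount a b) xs ≤ 1
adjSum-join≤1 a b []           _ = z≤n
adjSum-join≤1 a b (x ∷ [])     _ = z≤n
adjSum-join≤1 a b (x ∷ y ∷ xs) u@(_ ∷ u′) with joins? a b x y
... | no _ = adjSum-join≤1 a b (y ∷ xs) u′
... | yes (inj₁ (refl , _)) = ≤-reflexive (cong suc (adjSum-join-∉ a b (y ∷ xs) (Unique-head u)))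
... | yes (inj₂ (refl , _)) = ≤-reflexive (cong suc (trans (adjSum-cong (joinCount-sym a b) (y ∷ xs))
                                                             (adjSum-join-∉ b a (y ∷ xs) (Unique-head u))))

adjSum-touch-∉ : ∀ a xs → a ∉ xs → adjSum (touchCount a) xs ≡ 0
adjSum-touch-∉ a xs a∉ = adjSum-zero _ xs λ x∈ y∈ →
  𝟙-no (_ ≟ a ⊎-dec _ ≟ a) Sum.[ (λ { refl → a∉ x∈ }) , (λ { refl → a∉ y∈ }) ]

adjSum-touch-head≤1 : ∀ a xs → Unique (a ∷ xs) → adjSum (touchCount a) (a ∷ xs) ≤ 1
adjSum-touch-head≤1 a []       _ = z≤n
adjSum-touch-head≤1 a (y ∷ xs) u = begin
  touchCount a a y + adjSum (touchCount a) (y ∷ xs) ≡⟨ cong (touchCount a a y +_) (adjSum-touch-∉ a (y ∷ xs) (Unique-head u)) ⟩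
  touchCount a a y + 0                              ≤⟨ +-monoˡ-≤ 0 (𝟙≤1 _) ⟩
  1                                                 ∎
  where open ≤-Reasoning

adjSum-touch≤2 : ∀ a xs → Unique xs → adjSum (touchCount a) xs ≤ 2
adjSum-touch≤2 a []           _ = z≤n
adjSum-touch≤2 a (x ∷ [])     _ = z≤n
adjSum-touch≤2 a (x ∷ y ∷ xs) u@(_ ∷ u′) = by-cases (x ≟ a) (y ≟ a)
  where
  open ≤-Reasoning
  by-cases : Dec (x ≡ a) → Dec (y ≡ a) → adjSum (touchCount a) (x ∷ y ∷ xs) ≤ 2
  by-cases (yes refl) _        = ≤-trans (adjSum-touch-head≤1 x (y ∷ xs) u) (s≤s z≤n)
  by-cases (no _)    (yes refl) = +-mono-≤ (𝟙≤1 _) (adjSum-touch-head≤1 y xs u′)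
  by-cases (no x≢a)  (no y≢a)   = begin
    touchCount a x y + adjSum (touchCount a) (y ∷ xs) ≡⟨ cong (_+ _) (𝟙-no (x ≟ a ⊎-dec y ≟ a) Sum.[ x≢a , y≢a ]) ⟩
    adjSum (touchCount a) (y ∷ xs)                    ≤⟨ adjSum-touch≤2 a (y ∷ xs) u′ ⟩
    2                                                 ∎

Joins-exclusive : ∀ {a z z′ x y} → z ≢ a → z′ ≢ z → Joins a z x y → ¬ Joins a z′ x y
Joins-exclusive z≢a z′≢z (inj₁ (refl , refl)) (inj₁ (_ , z≡z′))  = z′≢z (sym z≡z′)
Joins-exclusive z≢a z′≢z (inj₁ (refl , refl)) (inj₂ (_ , z≡a))   = z≢a z≡a
Joins-exclusive z≢a z′≢z (inj₂ (refl , refl)) (inj₁ (z≡a , _))   = z≢a z≡a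
Joins-exclusive z≢a z′≢z (inj₂ (refl , refl)) (inj₂ (z≡z′ , _))  = z′≢z (sym z≡z′)

neighbourCount : ℕ → List ℕ → ℕ → ℕ → ℕ
neighbourCount a zs x y = sum (map (λ z → joinCount a z x y) zs)

neighbourCount≡0 : ∀ a zs {x y z} → z ≢ a → All (_≢ z) zs → Joins a z x y → neighbourCount a zs x y ≡ 0
neighbourCount≡0 a []        z≢a []             j = refl
neighbourCount≡0 a (z′ ∷ zs) z≢a (z′≢z ∷ zs≢z) j =
  cong₂ _+_ (𝟙-no (joins? a z′ _ _) (Joins-exclusive z≢a z′≢z j)) (neighbourCount≡0 a zs z≢a zs≢z j)

neighbourCount≤touchCount : ∀ a zs x y → Unique zs → All (_≢ a) zs → neighbourCount a zs x y ≤ touchCount a x y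
neighbourCount≤touchCount a []       x y _ _ = z≤n
neighbourCount≤touchCount a (z ∷ zs) x y (zs≢z ∷ u) (z≢a ∷ zs≢a) with joins? a z x y
... | no _  = neighbourCount≤touchCount a zs x y u zs≢a
... | yes j = ≤-reflexive (trans
      (cong suc (neighbourCount≡0 a zs z≢a (All.map (λ z≢z′ z′≡z → z≢z′ (sym z′≡z)) zs≢z) j))
      (sym (𝟙-yes (x ≟ a ⊎-dec y ≟ a) (Joins-touches j))))

adjSum-sum : ∀ {A : Set} (f : ℕ → A → A → ℕ) zs w →
  adjSum (λ x y → sum (map (λ z → f z x y) zs)) w ≡ sum (map (λ z → adjSum (f z) w) zs)
adjSum-sum f []       w = adjSum-zero _ w λ _ _ → refl
adjSum-sum f (z ∷ zs) w = trans (adjSum-+ (f z) _ w) (cong (adjSum (f z) w +_) (adjSum-sum f zs w))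

adjSum-neighbours≤2 : ∀ a zs w → Unique w → Unique (a ∷ zs) →
  sum (map (λ z → adjSum (joinCount a z) w) zs) ≤ 2
adjSum-neighbours≤2 a zs w w! (a≢zs ∷ zs!) = begin
  sum (map (λ z → adjSum (joinCount a z) w) zs) ≡⟨ sym (adjSum-sum (joinCount a) zs w) ⟩
  adjSum (neighbourCount a zs) w                ≤⟨ adjSum-mono (λ x y → neighbourCount≤touchCount a zs x y zs! zs≢a) w ⟩
  adjSum (touchCount a) w                       ≤⟨ adjSum-touch≤2 a w w! ⟩
  2                                             ∎
  where
  open ≤-Reasoning
  zs≢a = All.map ≢-sym a≢zs

triangleCount : ℕ → ℕ → ℕ → ℕ → ℕ → ℕ
triangleCount a b c x y = joinCount a b x y + joinCount a c x y + joinCount b c x y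

joinCount-outside : ∀ {a b x} y → x ≢ a → x ≢ b → joinCount a b x y ≡ 0
joinCount-outside y x≢a x≢b = 𝟙-no (joins? _ _ _ y) λ { (inj₁ (x≡a , _)) → x≢a x≡a ; (inj₂ (x≡b , _)) → x≢b x≡b }

triangleCount-swap : ∀ a b c x y → triangleCount a b c x y ≡ triangleCount b a c x y
triangleCount-swap a b c x y =
  trans (cong (λ t → t + joinCount a c x y + joinCount b c x y) (joinCount-sym a b x y))
        (+-swap (joinCount b a x y) (joinCount a c x y) (joinCount b c x y))
  where
  +-swap : ∀ p q r → p + q + r ≡ p + r + q
  +-swap = solve-∀

triangleCount-rotate : ∀ a b c x y → triangleCount a b c x y ≡ triangleCount c a b x y
triangleCount-rotate a b c x y =
  trans (+-rotate (joinCount a b x y) (joinCount a c x y) (joinCount b c x y))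
        (cong₂ (λ s t → s + t + joinCount a b x y) (joinCount-sym a c x y) (joinCount-sym b c x y))
  where
  +-rotate : ∀ p q r → p + q + r ≡ q + r + p
  +-rotate = solve-∀

adjSum-triangle-head≤2 : ∀ a b c y ys → a ≢ b → a ≢ c → b ≢ c → Unique (a ∷ y ∷ ys) →
  adjSum (triangleCount a b c) (a ∷ y ∷ ys) ≤ 2
adjSum-triangle-head≤2 a b c y ys a≢b a≢c b≢c u@(_ ∷ u′) = +-mono-≤ head≤1 tail≤1
  where
  a∉ = Unique-head u

  head≤1 : triangleCount a b c a y ≤ 1
  head≤1 rewrite joinCount-outside y a≢b a≢c | +-identityʳ (joinCount a b a y + joinCount a c a y)
    with joins? a b a y | joins? a c a y
  ... | yes j | yes j′ = ⊥-elim (b≢c (trans (sym (Joins-from a≢b j)) (Joins-from a≢c j′)))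
  ... | yes _ | no _  = s≤s z≤n
  ... | no _  | yes _ = s≤s z≤n
  ... | no _  | no _  = z≤n

  tail≤1 : adjSum (triangleCount a b c) (y ∷ ys) ≤ 1
  tail≤1 = begin
    adjSum (triangleCount a b c) (y ∷ ys)
      ≡⟨ adjSum-+ (λ x y → joinCount a b x y + joinCount a c x y) (joinCount b c) (y ∷ ys) ⟩
    adjSum (λ x y → joinCount a b x y + joinCount a c x y) (y ∷ ys) + adjSum (joinCount b c) (y ∷ ys)
      ≡⟨ cong (_+ _) (adjSum-+ (joinCount a b) (joinCount a c) (y ∷ ys)) ⟩
    adjSum (joinCount a b) (y ∷ ys) + adjSum (joinCount a c) (y ∷ ys) + adjSum (joinCount b c) (y ∷ ys)
      ≡⟨ cong₂ (λ s t → s + t + adjSum (joinCount b c) (y ∷ ys)) (adjSum-join-∉ a b _ a∉) (adjSum-join-∉ a c _ a∉) ⟩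
    adjSum (joinCount b c) (y ∷ ys)
      ≤⟨ adjSum-join≤1 b c (y ∷ ys) u′ ⟩
    1 ∎
    where open ≤-Reasoning

adjSum-triangle≤2 : ∀ a b c xs → a ≢ b → a ≢ c → b ≢ c → Unique xs → adjSum (triangleCount a b c) xs ≤ 2
adjSum-triangle≤2 a b c []           _ _ _ _ = z≤n
adjSum-triangle≤2 a b c (x ∷ [])     _ _ _ _ = z≤n
adjSum-triangle≤2 a b c (x ∷ y ∷ xs) a≢b a≢c b≢c u@(_ ∷ u′) = by-cases (x ≟ a) (x ≟ b) (x ≟ c)
  where
  open ≤-Reasoning
  by-cases : Dec (x ≡ a) → Dec (x ≡ b) → Dec (x ≡ c) → adjSum (triangleCount a b c) (x ∷ y ∷ xs) ≤ 2
  by-cases (yes refl) _ _ = adjSum-triangle-head≤2 a b c y xs a≢b a≢c b≢c u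
  by-cases (no _) (yes refl) _ = ≤-trans (≤-reflexive (adjSum-cong (triangleCount-swap a b c) (x ∷ y ∷ xs)))
    (adjSum-triangle-head≤2 b a c y xs (≢-sym a≢b) b≢c a≢c u)
  by-cases (no _) (no _) (yes refl) = ≤-trans (≤-reflexive (adjSum-cong (triangleCount-rotate a b c) (x ∷ y ∷ xs)))
    (adjSum-triangle-head≤2 c a b y xs (≢-sym a≢c) (≢-sym b≢c) a≢b u)
  by-cases (no x≢a) (no x≢b) (no x≢c) = begin
    triangleCount a b c x y + adjSum (triangleCount a b c) (y ∷ xs)
      ≡⟨ cong (_+ _) (cong₂ (λ s t → s + t + joinCount b c x y) (joinCount-outside y x≢a x≢b) (joinCount-outside y x≢a x≢c)) ⟩
    joinCount b c x y + adjSum (triangleCount a b c) (y ∷ xs)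
      ≡⟨ cong (_+ _) (joinCount-outside y x≢b x≢c) ⟩
    adjSum (triangleCount a b c) (y ∷ xs)
      ≤⟨ adjSum-triangle≤2 a b c (y ∷ xs) a≢b a≢c b≢c u′ ⟩
    2 ∎

triangleCount-pos₁ : ∀ {a b c x y} → Joins a b x y → 1 ≤ triangleCount a b c x y
triangleCount-pos₁ {a} {b} {c} {x} {y} j =
  ≤-trans (≤-reflexive (sym (𝟙-yes (joins? a b x y) j))) (≤-trans (m≤m+n _ _) (m≤m+n _ _))

triangleCount-pos₂ : ∀ {a b c x y} → Joins a c x y → 1 ≤ triangleCount a b c x y
triangleCount-pos₂ {a} {b} {c} {x} {y} j =
  ≤-trans (≤-reflexive (sym (𝟙-yes (joins? a c x y) j))) (≤-trans (m≤n+m _ (joinCount a b x y)) (m≤m+n _ _))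

triangleCount-pos₃ : ∀ {a b c x y} → Joins b c x y → 1 ≤ triangleCount a b c x y
triangleCount-pos₃ {a} {b} {c} {x} {y} j =
  ≤-trans (≤-reflexive (sym (𝟙-yes (joins? b c x y) j))) (m≤n+m _ _)

-- Heap numbering of the complete binary tree

n/2≡⌊n/2⌋ : ∀ n → n / 2 ≡ ⌊ n /2⌋
n/2≡⌊n/2⌋ 0             = refl
n/2≡⌊n/2⌋ 1             = refl
n/2≡⌊n/2⌋ (suc (suc n)) = trans (m/n≡1+[m∸n]/n {suc (suc n)} {2} (s≤s (s≤s z≤n))) (cong suc (n/2≡⌊n/2⌋ n))

⌊1+n+n/2⌋≡n : ∀ n → ⌊ suc (n + n) /2⌋ ≡ n
⌊1+n+n/2⌋≡n zero    = refl
⌊1+n+n/2⌋≡n (suc n) = cong suc (trans (cong ⌊_/2⌋ (+-suc n n)) (⌊1+n+n/2⌋≡n n))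

n≡⌊n/2⌋+⌊n/2⌋⊎1+ : ∀ n → n ≡ ⌊ n /2⌋ + ⌊ n /2⌋ ⊎ n ≡ suc (⌊ n /2⌋ + ⌊ n /2⌋)
n≡⌊n/2⌋+⌊n/2⌋⊎1+ 0 = inj₁ refl
n≡⌊n/2⌋+⌊n/2⌋⊎1+ 1 = inj₂ refl
n≡⌊n/2⌋+⌊n/2⌋⊎1+ (suc (suc n)) with n≡⌊n/2⌋+⌊n/2⌋⊎1+ n
... | inj₁ e = inj₁ (cong (suc ∘ suc) e ⟨ trans ⟩ cong suc (sym (+-suc ⌊ n /2⌋ ⌊ n /2⌋)))
... | inj₂ e = inj₂ (cong (suc ∘ suc) e ⟨ trans ⟩ cong (suc ∘ suc) (sym (+-suc ⌊ n /2⌋ ⌊ n /2⌋)))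

2*[1+n]≡2+n+n : ∀ n → 2 * suc n ≡ suc (suc (n + n))
2*[1+n]≡2+n+n = solve-∀

child : Bool → ℕ → ℕ
child false v = suc (v + v)
child true  v = suc (suc (v + v))

parent : ℕ → ℕ
parent zero    = zero
parent (suc u) = ⌊ u /2⌋

parent-child : ∀ b v → parent (child b v) ≡ v
parent-child false v = sym (n≡⌊n+n/2⌋ v)
parent-child true  v = ⌊1+n+n/2⌋≡n v

child-parent : ∀ u → .{{NonZero u}} → Σ Bool λ b → child b (parent u) ≡ u
child-parent (suc n) with n≡⌊n/2⌋+⌊n/2⌋⊎1+ n
... | inj₁ e = false , cong suc (sym e)
... | inj₂ e = true  , cong suc (sym e)

parent< : ∀ u → .{{NonZero u}} → parent u < u
parent< (suc n) = s≤s (⌊n/2⌋≤n n)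

child-injective : ∀ {b b′ v v′} → child b v ≡ child b′ v′ → b ≡ b′ × v ≡ v′
child-injective {b} {b′} {v} {v′} e with trans (sym (parent-child b v)) (trans (cong parent e) (parent-child b′ v′))
child-injective {false} {false} e | refl = refl , refl
child-injective {true}  {true}  e | refl = refl , refl
child-injective {false} {true}  e | refl = ⊥-elim (1+n≢n (sym (suc-injective e)))
child-injective {true}  {false} e | refl = ⊥-elim (1+n≢n (suc-injective e))

heap-induction : (P : ℕ → Set) → P 0 → (∀ b v → P v → P (child b v)) → ∀ v → P v
heap-induction P P0 Pchild = <-rec P via-parent
  where
  via-parent : ∀ v → (∀ {u} → u < v → P u) → P v
  via-parent zero      _   = P0
  via-parent v@(suc _) rec with child-parent v
  ... | b , e = subst P e (Pchild b (parent v) (rec (parent< v)))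

depth : ℕ → ℕ
depth v = ⌊log₂ suc v ⌋

depth-child : ∀ b v → depth (child b v) ≡ suc (depth v)
depth-child b v = begin
  depth (child b v)                        ≡⟨ sym (m∸n+n≡m 1≤d) ⟩
  depth (child b v) ∸ 1 + 1                ≡⟨ +-comm _ 1 ⟩
  suc (depth (child b v) ∸ 1)              ≡⟨ cong suc (sym (⌊log₂⌊n/2⌋⌋≡⌊log₂n⌋∸1 (suc (child b v)))) ⟩
  suc ⌊log₂ ⌊ suc (child b v) /2⌋ ⌋        ≡⟨ cong (λ n → suc ⌊log₂ n ⌋) (half b) ⟩
  suc (depth v)                            ∎
  where
  open ≡-Reasoning
  half : ∀ b → ⌊ suc (child b v) /2⌋ ≡ suc v
  half false = cong suc (sym (n≡⌊n+n/2⌋ v))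
  half true  = cong suc (⌊1+n+n/2⌋≡n v)
  child-pos : ∀ b → 1 ≤ child b v
  child-pos false = s≤s z≤n
  child-pos true  = s≤s z≤n
  1≤d : 1 ≤ depth (child b v)
  1≤d = ⌊log₂⌋-mono-≤ {2} {suc (child b v)} (s≤s (child-pos b))

depth-bounds : ∀ v → 2 ^ depth v ≤ suc v × suc v < 2 ^ suc (depth v)
depth-bounds = heap-induction _ (s≤s z≤n , s≤s (s≤s z≤n)) child-bounds
  where
  2*suc+2 : ∀ v → suc (suc (suc (suc (v + v)))) ≡ 2 * suc (suc v)
  2*suc+2 = solve-∀
  child-bounds : ∀ b v → 2 ^ depth v ≤ suc v × suc v < 2 ^ suc (depth v) →
         2 ^ depth (child b v) ≤ suc (child b v) × suc (child b v) < 2 ^ suc (depth (child b v))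
  child-bounds b v (lo , hi) rewrite depth-child b v = lo′ b , hi′ b
    where
    open ≤-Reasoning
    lo′ : ∀ b → 2 * 2 ^ depth v ≤ suc (child b v)
    lo′ b = begin
      2 * 2 ^ depth v       ≤⟨ *-monoʳ-≤ 2 lo ⟩
      2 * suc v             ≡⟨ 2*[1+n]≡2+n+n v ⟩
      suc (suc (v + v))     ≤⟨ s≤s (child-≥ b) ⟩
      suc (child b v)       ∎
      where
      child-≥ : ∀ b → suc (v + v) ≤ child b v
      child-≥ false = ≤-refl
      child-≥ true  = n≤1+n _
    hi′ : ∀ b → suc (child b v) < 2 * 2 ^ suc (depth v)
    hi′ b = begin-strict
      suc (child b v)       ≤⟨ s≤s (child-≤ b) ⟩
      suc (suc (suc (v + v))) <⟨ n<1+n _ ⟩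
      suc (suc (suc (suc (v + v)))) ≡⟨ 2*suc+2 v ⟩
      2 * suc (suc v)       ≤⟨ *-monoʳ-≤ 2 hi ⟩
      2 * 2 ^ suc (depth v) ∎
      where
      child-≤ : ∀ b → child b v ≤ suc (suc (v + v))
      child-≤ false = n≤1+n _
      child-≤ true  = ≤-refl

suc<2^⇒depth< : ∀ u d → suc u < 2 ^ d → depth u < d
suc<2^⇒depth< u d lt with depth u <? d
... | yes p = p
... | no ¬p = ⊥-elim (<⇒≱ lt (≤-trans (^-monoʳ-≤ 2 (≮⇒≥ ¬p)) (proj₁ (depth-bounds u))))

depth<⇒suc<2^ : ∀ u d → depth u < d → suc u < 2 ^ d
depth<⇒suc<2^ u d lt = <-≤-trans (proj₂ (depth-bounds u)) (^-monoʳ-≤ 2 lt)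

2^≤⇒≤depth : ∀ u D → 2 ^ D ≤ suc u → D ≤ depth u
2^≤⇒≤depth u D le with D ≤? depth u
... | yes p = p
... | no ¬p = ⊥-elim (<⇒≱ (depth<⇒suc<2^ u D (≰⇒> ¬p)) le)

2*suc⌊n/2⌋≤2+n : ∀ n → 2 * suc ⌊ n /2⌋ ≤ suc (suc n)
2*suc⌊n/2⌋≤2+n n with n≡⌊n/2⌋+⌊n/2⌋⊎1+ n
... | inj₁ e = ≤-reflexive (trans (2*[1+n]≡2+n+n ⌊ n /2⌋) (cong (suc ∘ suc) (sym e)))
... | inj₂ e = ≤-trans (≤-reflexive (2*[1+n]≡2+n+n ⌊ n /2⌋)) (s≤s (s≤s (≤-trans (n≤1+n _) (≤-reflexive (sym e)))))

descend : List Bool → ℕ → ℕ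
descend []       y = y
descend (b ∷ bs) y = child b (descend bs y)

ancestor : ℕ → ℕ → ℕ
ancestor zero    v = v
ancestor (suc t) v = ancestor t (parent v)

depth-descend : ∀ bs y → depth (descend bs y) ≡ length bs + depth y
depth-descend []       y = refl
depth-descend (b ∷ bs) y = trans (depth-child b (descend bs y)) (cong suc (depth-descend bs y))

ancestor-descend : ∀ bs y → ancestor (length bs) (descend bs y) ≡ y
ancestor-descend []       y = refl
ancestor-descend (b ∷ bs) y = trans (cong (ancestor (length bs)) (parent-child b (descend bs y))) (ancestor-descend bs y)

parent≤ : ∀ v → parent v ≤ v
parent≤ zero    = z≤n
parent≤ (suc u) = m≤n⇒m≤1+n (⌊n/2⌋≤n u)

ancestor≤ : ∀ t v → ancestor t v ≤ v
ancestor≤ zero    v = ≤-refl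
ancestor≤ (suc t) v = ≤-trans (ancestor≤ t (parent v)) (parent≤ v)

descend-ancestor : ∀ t v → t ≤ depth v → Σ (List Bool) λ bs → length bs ≡ t × descend bs (ancestor t v) ≡ v
descend-ancestor zero    v _ = [] , refl , refl
descend-ancestor (suc t) zero ()
descend-ancestor (suc t) v@(suc _) t<depth with child-parent v
... | b , e with descend-ancestor t (parent v) (≤-pred (≤-trans t<depth (≤-reflexive depth-v)))
  where
  depth-v : depth v ≡ suc (depth (parent v))
  depth-v = trans (cong depth (sym e)) (depth-child b (parent v))
... | bs , refl , e′ = b ∷ bs , refl , trans (cong (child b) e′) e

depth-ancestor : ∀ t v → t ≤ depth v → depth (ancestor t v) + t ≡ depth v
depth-ancestor t v t≤ with descend-ancestor t v t≤
... | bs , refl , e = trans (+-comm _ (length bs)) (trans (sym (depth-descend bs _)) (cong depth e))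

descend-injective : ∀ {bs bs′} y → descend bs y ≡ descend bs′ y → bs ≡ bs′
descend-injective {bs} {bs′} y e =
  go bs bs′ (+-cancelʳ-≡ (depth y) _ _ (trans (sym (depth-descend bs y)) (trans (cong depth e) (depth-descend bs′ y)))) e
  where
  go : ∀ bs bs′ → length bs ≡ length bs′ → descend bs y ≡ descend bs′ y → bs ≡ bs′
  go []       []         _ _ = refl
  go (b ∷ bs) (b′ ∷ bs′) l e with child-injective e
  ... | refl , e′ = cong (b ∷_) (go bs bs′ (suc-injective l) e′)

-- Lower bound on g

-- A feasible solution of the linear program behind LocalStep, whose variables are the links
-- at a vertex: A between its up edge and left edge, B between its up edge and right edge,
-- C between its two down edges, and s₁, s₂ between the up edge of a child and its down edges.
potentialTable : ℕ → ℕ → ℕ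
potentialTable 0 _ = 43
potentialTable 1 0 = 79
potentialTable 1 _ = 29
potentialTable 2 2 = 1
potentialTable 2 _ = 51
potentialTable 3 _ = 45
potentialTable _ 0 = 59
potentialTable _ 1 = 33
potentialTable _ _ = 9

potential : ℕ → ℕ → ℕ
potential h = potentialTable (4 ⊓ h)

LocalStep : ℕ → ℕ → Set
LocalStep k k′ = ∀ {A} → A < 2 → ∀ {B} → B < 2 → ∀ {C} → C < 2 → ∀ {s₁} → s₁ < 3 → ∀ {s₂} → s₂ < 3 →
  A + B + C ≤ 2 → A + C + s₁ ≤ 2 → B + C + s₂ ≤ 2 →
  50 * (A + B + C) + potentialTable k′ (A + B) ≤ potentialTable k s₁ + potentialTable k s₂ + 43

localStep? : ∀ k k′ → Dec (LocalStep k k′)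
localStep? k k′ =
  allUpTo? (λ A → allUpTo? (λ B → allUpTo? (λ C → allUpTo? (λ s₁ → allUpTo? (λ s₂ →
    A + B + C ≤? 2 →-dec A + C + s₁ ≤? 2 →-dec B + C + s₂ ≤? 2 →-dec
    50 * (A + B + C) + potentialTable k′ (A + B) ≤? potentialTable k s₁ + potentialTable k s₂ + 43) 3) 3) 2) 2) 2

localStep : ∀ h → LocalStep (4 ⊓ h) (4 ⊓ suc h)
localStep 0                             = from-yes (localStep? 0 1)
localStep 1                             = from-yes (localStep? 1 2)
localStep 2                             = from-yes (localStep? 2 3)
localStep 3                             = from-yes (localStep? 3 4)
localStep (suc (suc (suc (suc _))))     = from-yes (localStep? 4 4)

-- Edge i of B_d joins i / 2 to i + 1, so the edge above v ≥ 1 is v ∸ 1 (upEdge 0 = 0 is junk).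
upEdge : ℕ → ℕ
upEdge v = v ∸ 1

downEdge : Bool → ℕ → ℕ
downEdge b v = upEdge (child b v)

localLinks : ℕ → ℕ → ℕ → ℕ
localLinks v = triangleCount (upEdge v) (downEdge false v) (downEdge true v)

subtreeLinks : ℕ → ℕ → ℕ → ℕ → ℕ
subtreeLinks zero    v x y = 0
subtreeLinks (suc h) v x y = localLinks v x y + (subtreeLinks h (child false v) x y + subtreeLinks h (child true v) x y)

child-nonZero : ∀ b v → NonZero (child b v)
child-nonZero false v = _
child-nonZero true  v = _

increasing⇒Unique : ∀ {xs} → Linked _<_ xs → Unique xs
increasing⇒Unique = AllPairs.map <⇒≢ ∘ Linked⇒AllPairs <-trans

module LinkCounts (w : List ℕ) (w! : Unique w) where

  links : ℕ → ℕ → ℕ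
  links a b = adjSum (joinCount a b) w

  upLinks : ℕ → ℕ
  upLinks v = links (upEdge v) (downEdge false v) + links (upEdge v) (downEdge true v)

  linksAt : ℕ → ℕ
  linksAt v = upLinks v + links (downEdge false v) (downEdge true v)

  linksBelow : ℕ → ℕ → ℕ
  linksBelow h v = adjSum (subtreeLinks h v) w

  links≤1 : ∀ a b → links a b ≤ 1
  links≤1 a b = adjSum-join≤1 a b w w!

  upLinks≤2 : ∀ v → upLinks v ≤ 2
  upLinks≤2 v = +-mono-≤ (links≤1 _ _) (links≤1 _ _)

  linksAt≤3 : ∀ v → linksAt v ≤ 3
  linksAt≤3 v = +-mono-≤ (upLinks≤2 v) (links≤1 _ _)

  adjSum-localLinks : ∀ v → adjSum (localLinks v) w ≡ linksAt v
  adjSum-localLinks v =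
    trans (adjSum-+ _ _ w) (cong (_+ links (downEdge false v) (downEdge true v)) (adjSum-+ _ _ w))

  linksBelow-suc : ∀ h v → linksBelow (suc h) v ≡ linksAt v + (linksBelow h (child false v) + linksBelow h (child true v))
  linksBelow-suc h v = trans (adjSum-+ (localLinks v) _ w) (cong₂ _+_ (adjSum-localLinks v) (adjSum-+ _ _ w))

  up<left : ∀ v → .{{NonZero v}} → upEdge v < downEdge false v
  up<left (suc v) = s≤s (m≤m+n v (suc v))

  left<right : ∀ v → downEdge false v < downEdge true v
  left<right v = n<1+n _

  right<below : ∀ b v → downEdge true v < downEdge false (child b v)
  right<below false v = m<m+n (suc (v + v)) (s≤s z≤n)
  right<below true  v = <-trans (n<1+n _) (m<m+n (suc (suc (v + v))) (s≤s z≤n))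

  linksAt≤2 : ∀ v → .{{NonZero v}} → linksAt v ≤ 2
  linksAt≤2 v = subst (_≤ 2) (adjSum-localLinks v)
    (adjSum-triangle≤2 _ _ _ w (<⇒≢ (up<left v)) (<⇒≢ (<-trans (up<left v) (left<right v))) (<⇒≢ (left<right v)) w!)

  links-sym : ∀ a b → links a b ≡ links b a
  links-sym a b = adjSum-cong (joinCount-sym a b) w

  capacity : ∀ a zs → Unique (a ∷ zs) → sum (map (links a) zs) ≤ 2
  capacity a zs = adjSum-neighbours≤2 a zs w w!

  private
    regroup : ∀ p q r s → p + q + (r + s) ≡ p + (q + (r + (s + 0)))
    regroup = solve-∀

  leftEdge-capacity : ∀ v → .{{NonZero v}} →
    links (upEdge v) (downEdge false v) + links (downEdge false v) (downEdge true v) + upLinks (child false v) ≤ 2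
  leftEdge-capacity v = begin
    links up a + links a right + upLinks c                    ≡⟨ cong (λ t → t + links a right + upLinks c) (links-sym up a) ⟩
    links a up + links a right + (links a c₁ + links a c₂)   ≡⟨ regroup (links a up) (links a right) (links a c₁) (links a c₂) ⟩
    sum (map (links a) (up ∷ right ∷ c₁ ∷ c₂ ∷ []))          ≤⟨ capacity a _ (Perm.Unique-resp-↭ (setoid ℕ) (↭⇒↭ₛ (shift a [ up ] _)) sorted!) ⟩
    2                                                        ∎
    where
    open ≤-Reasoning
    up = upEdge v
    a = downEdge false v
    right = downEdge true v
    c = child false v
    c₁ = downEdge false c
    c₂ = downEdge true c
    sorted! = increasing⇒Unique (up<left v ∷ left<right v ∷ right<below false v ∷ left<right c ∷ [-])

  rightEdge-capacity : ∀ v → .{{NonZero v}} →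
    links (upEdge v) (downEdge true v) + links (downEdge false v) (downEdge true v) + upLinks (child true v) ≤ 2
  rightEdge-capacity v = begin
    links up a + links left a + upLinks c                    ≡⟨ cong₂ (λ s t → s + t + upLinks c) (links-sym up a) (links-sym left a) ⟩
    links a up + links a left + (links a c₁ + links a c₂)   ≡⟨ regroup (links a up) (links a left) (links a c₁) (links a c₂) ⟩
    sum (map (links a) (up ∷ left ∷ c₁ ∷ c₂ ∷ []))          ≤⟨ capacity a _ (Perm.Unique-resp-↭ (setoid ℕ) (↭⇒↭ₛ (shift a (up ∷ left ∷ []) _)) sorted!) ⟩
    2                                                       ∎
    where
    open ≤-Reasoning
    up = upEdge v
    left = downEdge false v
    a = downEdge true v
    c = child true v
    c₁ = downEdge false c
    c₂ = downEdge true c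
    sorted! = increasing⇒Unique (up<left v ∷ left<right v ∷ right<below true v ∷ left<right c ∷ [-])

  linksBelow-zero : ∀ v → linksBelow 0 v ≡ 0
  linksBelow-zero v = adjSum-zero _ w λ _ _ → refl

  potential-invariant : ∀ h v → .{{NonZero v}} → 50 * linksBelow h v + potential h (upLinks v) + 43 ≤ 43 * 2 ^ suc h
  potential-invariant zero v rewrite linksBelow-zero v = ≤-refl
  potential-invariant (suc h) v = begin
    50 * linksBelow (suc h) v + potential (suc h) (upLinks v) + 43
      ≡⟨ cong (λ n → 50 * n + potential (suc h) (upLinks v) + 43) (linksBelow-suc h v) ⟩
    50 * (linksAt v + (linksBelow h l + linksBelow h r)) + potential (suc h) (upLinks v) + 43
      ≤⟨ combine (linksAt v) (linksBelow h l) (linksBelow h r)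
                 (potential (suc h) (upLinks v)) (potential h (upLinks l)) (potential h (upLinks r))
                 (localStep h (s≤s (links≤1 _ _)) (s≤s (links≤1 _ _)) (s≤s (links≤1 _ _))
                              (s≤s (upLinks≤2 l)) (s≤s (upLinks≤2 r))
                              (linksAt≤2 v) (leftEdge-capacity v) (rightEdge-capacity v))
                 (potential-invariant h l {{child-nonZero false v}})
                 (potential-invariant h r {{child-nonZero true v}}) ⟩
    43 * 2 ^ suc h + 43 * 2 ^ suc h
      ≡⟨ double (2 ^ suc h) ⟩
    43 * 2 ^ suc (suc h) ∎
    where
    open ≤-Reasoning
    l = child false v
    r = child true v
    double : ∀ n → 43 * n + 43 * n ≡ 43 * (2 * n)
    double = solve-∀
    combine : ∀ t L₁ L₂ p p₁ p₂ {K} → 50 * t + p ≤ p₁ + p₂ + 43 → 50 * L₁ + p₁ + 43 ≤ K → 50 * L₂ + p₂ + 43 ≤ K →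
              50 * (t + (L₁ + L₂)) + p + 43 ≤ K + K
    combine t L₁ L₂ p p₁ p₂ {K} local ih₁ ih₂ = begin
      50 * (t + (L₁ + L₂)) + p + 43             ≡⟨ split t L₁ L₂ p ⟩
      (50 * t + p) + (50 * L₁ + 50 * L₂ + 43)  ≤⟨ +-monoˡ-≤ _ local ⟩
      (p₁ + p₂ + 43) + (50 * L₁ + 50 * L₂ + 43) ≡⟨ merge L₁ L₂ p₁ p₂ ⟩
      (50 * L₁ + p₁ + 43) + (50 * L₂ + p₂ + 43) ≤⟨ +-mono-≤ ih₁ ih₂ ⟩
      K + K                                      ∎
      where
      split : ∀ t L₁ L₂ p → 50 * (t + (L₁ + L₂)) + p + 43 ≡ (50 * t + p) + (50 * L₁ + 50 * L₂ + 43)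
      split = solve-∀
      merge : ∀ L₁ L₂ p₁ p₂ → (p₁ + p₂ + 43) + (50 * L₁ + 50 * L₂ + 43) ≡ (50 * L₁ + p₁ + 43) + (50 * L₂ + p₂ + 43)
      merge = solve-∀

  linksBelow-root : ∀ h → 50 * linksBelow (suc h) 0 + 86 ≤ 150 + 43 * 2 ^ suc (suc h)
  linksBelow-root h = begin
    50 * linksBelow (suc h) 0 + 86
      ≡⟨ cong (λ n → 50 * n + 86) (linksBelow-suc h 0) ⟩
    50 * (linksAt 0 + (linksBelow h 1 + linksBelow h 2)) + 86
      ≡⟨ split (linksAt 0) (linksBelow h 1) (linksBelow h 2) ⟩
    50 * linksAt 0 + ((50 * linksBelow h 1 + 43) + (50 * linksBelow h 2 + 43))
      ≤⟨ +-mono-≤ (*-monoʳ-≤ 50 (linksAt≤3 0)) (+-mono-≤ (drop-potential 1) (drop-potential 2)) ⟩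
    150 + (43 * 2 ^ suc h + 43 * 2 ^ suc h)
      ≡⟨ cong (150 +_) (double (2 ^ suc h)) ⟩
    150 + 43 * 2 ^ suc (suc h) ∎
    where
    open ≤-Reasoning
    split : ∀ t L₁ L₂ → 50 * (t + (L₁ + L₂)) + 86 ≡ 50 * t + ((50 * L₁ + 43) + (50 * L₂ + 43))
    split = solve-∀
    double : ∀ n → 43 * n + 43 * n ≡ 43 * (2 * n)
    double = solve-∀
    drop-potential : ∀ v → .{{NonZero v}} → 50 * linksBelow h v + 43 ≤ 43 * 2 ^ suc h
    drop-potential v = ≤-trans (+-monoˡ-≤ 43 (m≤m+n _ _)) (potential-invariant h v)

data InSubtree : ℕ → ℕ → ℕ → Set where
  here  : ∀ {h v} → InSubtree (suc h) v v
  under : ∀ {h v u} b → InSubtree h (child b v) u → InSubtree (suc h) v u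

InSubtree-child : ∀ {h v u} b → InSubtree h v u → InSubtree (suc h) v (child b u)
InSubtree-child b here          = under b here
InSubtree-child b (under b′ sub) = under b′ (InSubtree-child b sub)

InSubtree-root : ∀ u {h} → depth u < h → InSubtree h 0 u
InSubtree-root = heap-induction (λ u → ∀ {h} → depth u < h → InSubtree h 0 u) root grow
  where
  root : ∀ {h} → depth 0 < h → InSubtree h 0 0
  root {suc h} _ = here
  grow : ∀ b v → (∀ {h} → depth v < h → InSubtree h 0 v) → ∀ {h} → depth (child b v) < h → InSubtree h 0 (child b v)
  grow b v ih {suc h} lt = InSubtree-child b (ih (≤-pred (subst (_< suc h) (depth-child b v) lt)))

localLinks≤subtreeLinks : ∀ {h v u} → InSubtree h v u → ∀ x y → localLinks u x y ≤ subtreeLinks h v x y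
localLinks≤subtreeLinks here x y = m≤m+n _ _
localLinks≤subtreeLinks {suc h} {v} (under false sub) x y =
  ≤-trans (localLinks≤subtreeLinks sub x y) (≤-trans (m≤m+n _ _) (m≤n+m _ (localLinks v x y)))
localLinks≤subtreeLinks {suc h} {v} (under true sub) x y =
  ≤-trans (localLinks≤subtreeLinks sub x y) (≤-trans (m≤n+m _ _) (m≤n+m _ (localLinks v x y)))

edge-down : ∀ x → Σ Bool λ b → downEdge b (x / 2) ≡ x
edge-down x with child-parent (suc x)
... | b , e = b , trans (cong (downEdge b) (n/2≡⌊n/2⌋ x)) (cong (_∸ 1) e)

1≤localLinks-up : ∀ b u {x y} → Joins (upEdge u) (downEdge b u) x y → 1 ≤ localLinks u x y
1≤localLinks-up false u = triangleCount-pos₁ {upEdge u} {downEdge false u} {downEdge true u}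
1≤localLinks-up true  u = triangleCount-pos₂ {upEdge u} {downEdge false u} {downEdge true u}

1≤localLinks-siblings : ∀ b b′ u → downEdge b u ≢ downEdge b′ u → 1 ≤ localLinks u (downEdge b u) (downEdge b′ u)
1≤localLinks-siblings false false u x≢y = ⊥-elim (x≢y refl)
1≤localLinks-siblings true  true  u x≢y = ⊥-elim (x≢y refl)
1≤localLinks-siblings false true  u _   = triangleCount-pos₃ {upEdge u} {downEdge false u} {downEdge true u} (inj₁ (refl , refl))
1≤localLinks-siblings true  false u _   = triangleCount-pos₃ {upEdge u} {downEdge false u} {downEdge true u} (inj₂ (refl , refl))

shareEnd⇒localLink : ∀ x y → x ≢ y → ShareEnd (x / 2 , suc x) (y / 2 , suc y) →
  Σ ℕ λ u → (u ≡ x / 2 ⊎ u ≡ y / 2) × 1 ≤ localLinks u x y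
shareEnd⇒localLink x y x≢y (inj₁ x/2≡y/2) with edge-down x | edge-down y
... | b , ex | b′ , ey = x / 2 , inj₁ refl ,
  subst₂ (λ s t → 1 ≤ localLinks (x / 2) s t) ex ey′ (1≤localLinks-siblings b b′ (x / 2) λ e → x≢y (trans (sym ex) (trans e ey′)))
  where
  ey′ : downEdge b′ (x / 2) ≡ y
  ey′ = trans (cong (downEdge b′) x/2≡y/2) ey
shareEnd⇒localLink x y x≢y (inj₂ (inj₁ x/2≡1+y)) with edge-down x
... | b , e = x / 2 , inj₁ refl , 1≤localLinks-up b (x / 2) (inj₂ (sym e , cong (_∸ 1) (sym x/2≡1+y)))
shareEnd⇒localLink x y x≢y (inj₂ (inj₂ (inj₁ 1+x≡y/2))) with edge-down y
... | b , e = y / 2 , inj₂ refl , 1≤localLinks-up b (y / 2) (inj₁ (cong (_∸ 1) 1+x≡y/2 , sym e))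
shareEnd⇒localLink x y x≢y (inj₂ (inj₂ (inj₂ 1+x≡1+y))) = ⊥-elim (x≢y (suc-injective 1+x≡1+y))

numV∸1+2 : ∀ d → numV d ∸ 1 + 2 ≡ 2 ^ suc d
numV∸1+2 d = go (2 ^ d) (m^n>0 2 d)
  where
  go : ∀ a → 0 < a → 2 * a ∸ 1 ∸ 1 + 2 ≡ 2 * a
  go (suc a) _ = begin
    2 * suc a ∸ 1 ∸ 1 + 2 ≡⟨ cong (λ n → n ∸ 1 ∸ 1 + 2) (2*[1+n]≡2+n+n a) ⟩
    a + a + 2             ≡⟨ +-comm (a + a) 2 ⟩
    suc (suc (a + a))     ≡⟨ sym (2*[1+n]≡2+n+n a) ⟩
    2 * suc a             ∎
    where open ≡-Reasoning

edgeParent-depth : ∀ d x → x < numV d ∸ 1 → depth (x / 2) < d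
edgeParent-depth d x x<E rewrite n/2≡⌊n/2⌋ x = suc<2^⇒depth< ⌊ x /2⌋ d (*-cancelˡ-< 2 _ _ (begin-strict
  2 * suc ⌊ x /2⌋ ≤⟨ 2*suc⌊n/2⌋≤2+n x ⟩
  suc (suc x)     ≡⟨ +-comm 2 x ⟩
  x + 2           <⟨ +-monoˡ-< 2 x<E ⟩
  numV d ∸ 1 + 2  ≡⟨ numV∸1+2 d ⟩
  2 * 2 ^ d       ∎))
  where open ≤-Reasoning

treeEdge : ℕ → Edge
treeEdge i = (i / 2 , suc i)

lineAdj⇒subtreeLink : ∀ d (i j : Fin (length (BEdges d))) → LineAdj (BEdges d) i j → 1 ≤ subtreeLinks d 0 (toℕ i) (toℕ j)
lineAdj⇒subtreeLink d i j (i≢j , share) with shareEnd⇒localLink (toℕ i) (toℕ j) (i≢j ∘ toℕ-injective) share′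
  where share′ = subst₂ ShareEnd (lookup-applyUpTo treeEdge (numV d ∸ 1) i) (lookup-applyUpTo treeEdge (numV d ∸ 1) j) share
... | u , u≡ , 1≤link = ≤-trans 1≤link (localLinks≤subtreeLinks (InSubtree-root u (depth-bound u≡)) _ _)
  where
  edge< : ∀ k → toℕ k < numV d ∸ 1
  edge< k = subst (toℕ k <_) (length-applyUpTo treeEdge (numV d ∸ 1)) (toℕ<n k)
  depth-bound : u ≡ toℕ i / 2 ⊎ u ≡ toℕ j / 2 → depth u < d
  depth-bound (inj₁ refl) = edgeParent-depth d (toℕ i) (edge< i)
  depth-bound (inj₂ refl) = edgeParent-depth d (toℕ j) (edge< j)

module _ {m} {Adj : Fin m → Fin m → Set} (f : Fin m → Fin m → ℕ) (Adj⇒f : ∀ {i j} → Adj i j → 1 ≤ f i j) where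

  walk-length≤ : ∀ {p} → Walk Adj p → length p ≤ suc (adjSum f p)
  walk-length≤ (single _)           = s≤s z≤n
  walk-length≤ (step _ v vs adj ws) = s≤s (≤-trans (walk-length≤ ws) (+-monoˡ-≤ (adjSum f (v ∷ vs)) (Adj⇒f adj)))

  walks-length≤ : ∀ {ps} → All (Walk Adj) ps → length (concat ps) ≤ length ps + adjSum f (concat ps)
  walks-length≤ [] = z≤n
  walks-length≤ {p ∷ ps} (w ∷ ws) = begin
    length (p ++ concat ps)                                   ≡⟨ length-++ p ⟩
    length p + length (concat ps)                             ≤⟨ +-mono-≤ (walk-length≤ w) (walks-length≤ ws) ⟩
    suc (adjSum f p) + (length ps + adjSum f (concat ps))     ≡⟨ cong suc (regroup (adjSum f p) (length ps) _) ⟩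
    suc (length ps + (adjSum f p + adjSum f (concat ps)))     ≤⟨ s≤s (+-monoʳ-≤ (length ps) (adjSum-++ f p (concat ps))) ⟩
    suc (length ps + adjSum f (p ++ concat ps))               ∎
    where
    open ≤-Reasoning
    regroup : ∀ a b c → a + (b + c) ≡ b + (a + c)
    regroup = solve-∀

lineGraph-pathCover-lowerBound : ∀ h g → HasPathCover (LineAdj (BEdges (suc h))) g → 7 * 2 ^ suc (suc h) ≤ 50 * g + 164
lineGraph-pathCover-lowerBound h g (ps , refl , walks , ps↭) =
  arithmetic (numV d ∸ 1) (length ps) (linksBelow d 0) (numV∸1+2 d) edges≤ (linksBelow-root h)
  where
  d = suc h
  word = map toℕ (concat ps)
  word! : Unique word
  word! = map⁺ toℕ-injective (Perm.Unique-resp-↭ (setoid _) (↭⇒↭ₛ (↭-sym ps↭)) (allFin⁺ _))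
  open LinkCounts word word!
  edges≤ : numV d ∸ 1 ≤ length ps + linksBelow d 0
  edges≤ = begin
    numV d ∸ 1                         ≡⟨ sym (length-applyUpTo treeEdge (numV d ∸ 1)) ⟩
    length (BEdges d)                  ≡⟨ sym (trans (↭-length ps↭) (length-tabulate (λ i → i))) ⟩
    length (concat ps)                 ≤⟨ walks-length≤ _ (lineAdj⇒subtreeLink d _ _) walks ⟩
    length ps + adjSum (λ i j → subtreeLinks d 0 (toℕ i) (toℕ j)) (concat ps)
                                       ≡⟨ cong (length ps +_) (sym (adjSum-map toℕ (subtreeLinks d 0) (concat ps))) ⟩
    length ps + linksBelow d 0         ∎
    where open ≤-Reasoning
  arithmetic : ∀ E {T} g R → E + 2 ≡ T → E ≤ g + R → 50 * R + 86 ≤ 150 + 43 * T → 7 * T ≤ 50 * g + 164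
  arithmetic E {T} g R refl E≤ R≤ = +-cancelʳ-≤ (43 * T + 86) _ _ (begin
    7 * T + (43 * T + 86)            ≡⟨ e₁ E ⟩
    50 * E + 186                      ≤⟨ +-monoˡ-≤ 186 (*-monoʳ-≤ 50 E≤) ⟩
    50 * (g + R) + 186                ≡⟨ e₂ g R ⟩
    (50 * g + 100) + (50 * R + 86)    ≤⟨ +-monoʳ-≤ (50 * g + 100) R≤ ⟩
    (50 * g + 100) + (150 + 43 * T)   ≡⟨ e₃ g E ⟩
    50 * g + 164 + (43 * T + 86)      ∎)
    where
    open ≤-Reasoning
    e₁ : ∀ E → 7 * (E + 2) + (43 * (E + 2) + 86) ≡ 50 * E + 186
    e₁ = solve-∀
    e₂ : ∀ g R → 50 * (g + R) + 186 ≡ (50 * g + 100) + (50 * R + 86)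
    e₂ = solve-∀
    e₃ : ∀ g E → (50 * g + 100) + (150 + 43 * (E + 2)) ≡ 50 * g + 164 + (43 * (E + 2) + 86)
    e₃ = solve-∀

-- Upper bound on p

-- Levels above r are top; from level r on, every fourth level consists of roots of gadgets and
-- the three levels below a root are inner.
data Role : Set where
  top root inner : Role

cycleRole : ℕ → Role
cycleRole 0 = root
cycleRole 1 = inner
cycleRole 2 = inner
cycleRole 3 = inner
cycleRole (suc (suc (suc (suc n)))) = cycleRole n

roleAt : ℕ → ℕ → Role
roleAt zero    D       = cycleRole D
roleAt (suc r) zero    = top
roleAt (suc r) (suc D) = roleAt r D

cycleRole≢top : ∀ D → cycleRole D ≢ top
cycleRole≢top 0 ()
cycleRole≢top 1 ()
cycleRole≢top 2 ()
cycleRole≢top 3 ()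
cycleRole≢top (suc (suc (suc (suc D)))) = cycleRole≢top D

roleAt-top⇒< : ∀ r D → roleAt r D ≡ top → D < r
roleAt-top⇒< zero    D       e = ⊥-elim (cycleRole≢top D e)
roleAt-top⇒< (suc r) zero    _ = s≤s z≤n
roleAt-top⇒< (suc r) (suc D) e = s≤s (roleAt-top⇒< r D e)

<⇒roleAt-top : ∀ r D → D < r → roleAt r D ≡ top
<⇒roleAt-top (suc r) zero    _        = refl
<⇒roleAt-top (suc r) (suc D) (s≤s lt) = <⇒roleAt-top r D lt

roleAt-shift : ∀ r j → roleAt r (r + j) ≡ cycleRole j
roleAt-shift zero    j = refl
roleAt-shift (suc r) j = roleAt-shift r j

cycleRole-inner : ∀ D → cycleRole D ≡ inner → Σ ℕ λ t → 1 ≤ t × t ≤ 3 × t ≤ D × cycleRole (D ∸ t) ≡ root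
cycleRole-inner 1 _ = 1 , s≤s z≤n , s≤s z≤n , s≤s z≤n , refl
cycleRole-inner 2 _ = 2 , s≤s z≤n , s≤s (s≤s z≤n) , ≤-refl , refl
cycleRole-inner 3 _ = 3 , s≤s z≤n , ≤-refl , ≤-refl , refl
cycleRole-inner (suc (suc (suc (suc D)))) e with cycleRole-inner D e
... | t , 1≤t , t≤3 , t≤D , root-above = t , 1≤t , t≤3 , ≤-trans t≤D (m≤n+m D 4) ,
      trans (cong cycleRole (+-∸-assoc 4 t≤D)) root-above

roleAt-inner : ∀ r D → roleAt r D ≡ inner → Σ ℕ λ t → 1 ≤ t × t ≤ 3 × t ≤ D × roleAt r (D ∸ t) ≡ root
roleAt-inner zero    D       e = cycleRole-inner D e
roleAt-inner (suc r) (suc D) e with roleAt-inner r D e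
... | t , 1≤t , t≤3 , t≤D , root-above = t , 1≤t , t≤3 , m≤n⇒m≤1+n t≤D ,
      trans (cong (roleAt (suc r)) (+-∸-assoc 1 t≤D)) root-above

cycleRole-root-bound : ∀ q D → cycleRole D ≡ root → D ≤ 4 * q + 3 → D + 3 ≤ 4 * q + 3
cycleRole-root-bound q       zero _ _ = m≤n+m 3 (4 * q)
cycleRole-root-bound zero    (suc (suc (suc (suc D)))) _ (s≤s (s≤s (s≤s ())))
cycleRole-root-bound (suc q) (suc (suc (suc (suc D)))) e le =
  subst (4 + D + 3 ≤_) (sym 4q+7)
    (s≤s (s≤s (s≤s (s≤s (cycleRole-root-bound q D e (≤-pred (≤-pred (≤-pred (≤-pred (subst (4 + D ≤_) 4q+7 le))))))))))
  where
  4q+7 : 4 * suc q + 3 ≡ 4 + (4 * q + 3)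
  4q+7 = cong (_+ 3) (*-suc 4 q)

roleAt-root-bound : ∀ r q D → roleAt r D ≡ root → D ≤ r + (4 * q + 3) → D + 3 ≤ r + (4 * q + 3)
roleAt-root-bound zero    q D       e le       = cycleRole-root-bound q D e le
roleAt-root-bound (suc r) q (suc D) e (s≤s le) = s≤s (roleAt-root-bound r q D e le)

cycleOffset : ℕ → ℕ
cycleOffset (suc (suc (suc (suc n)))) = cycleOffset n
cycleOffset n = n

-- The number of levels from a vertex up to the owner of the edge above it.
ownerDistance : ℕ → ℕ → ℕ
ownerDistance zero    zero    = 1
ownerDistance zero    (suc D) = cycleOffset (suc D)
ownerDistance (suc r) zero    = 1
ownerDistance (suc r) (suc D) = ownerDistance r D

cycleOffset-root+ : ∀ D t → cycleRole D ≡ root → t ≤ 3 → cycleOffset (D + t) ≡ t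
cycleOffset-root+ 0 0 _ _ = refl
cycleOffset-root+ 0 1 _ _ = refl
cycleOffset-root+ 0 2 _ _ = refl
cycleOffset-root+ 0 3 _ _ = refl
cycleOffset-root+ 0 (suc (suc (suc (suc _)))) _ (s≤s (s≤s (s≤s ())))
cycleOffset-root+ (suc (suc (suc (suc D)))) t e t≤3 = cycleOffset-root+ D t e t≤3

ownerDistance-root+ : ∀ r D t → roleAt r D ≡ root → 1 ≤ t → t ≤ 3 → ownerDistance r (D + t) ≡ t
ownerDistance-root+ zero    zero    (suc t) e _ t≤3 = cycleOffset-root+ 0 (suc t) e t≤3
ownerDistance-root+ zero    (suc D) t       e _ t≤3 = cycleOffset-root+ (suc D) t e t≤3
ownerDistance-root+ (suc r) (suc D) t       e 1≤t t≤3 = ownerDistance-root+ r D t e 1≤t t≤3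

ownerDistance-top+1 : ∀ r D → roleAt r D ≡ top → ownerDistance r (D + 1) ≡ 1
ownerDistance-top+1 zero    D       e = ⊥-elim (cycleRole≢top D e)
ownerDistance-top+1 (suc r) zero    _ = lemma r
  where
  lemma : ∀ r → ownerDistance r 0 ≡ 1
  lemma zero    = refl
  lemma (suc r) = refl
ownerDistance-top+1 (suc r) (suc D) e = ownerDistance-top+1 r D e

data Path {A : Set} (R : A → A → Set) : List A → Set where
  end  : ∀ x → Path R (x ∷ [])
  link : ∀ {x y ys} → R x y → Path R (y ∷ ys) → Path R (x ∷ y ∷ ys)

Path-map : ∀ {A B : Set} {R : A → A → Set} {S : B → B → Set} (f : A → B) →
           (∀ {x y} → R x y → S (f x) (f y)) → ∀ {xs} → Path R xs → Path S (map f xs)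
Path-map f R⇒S (end x)     = end (f x)
Path-map f R⇒S (link r rs) = link (R⇒S r) (Path-map f R⇒S rs)

pattern L = false
pattern R = true

data Adjacent : List Bool → List Bool → Set where
  siblings : ∀ b b′ bs → Adjacent (b ∷ bs) (b′ ∷ bs)
  down     : ∀ b b′ bs → Adjacent (b ∷ bs) (b′ ∷ b ∷ bs)
  up       : ∀ b b′ bs → Adjacent (b′ ∷ b ∷ bs) (b ∷ bs)

CodeStep : List Bool → List Bool → Set
CodeStep c c′ = c ≢ c′ × Adjacent c c′

-- A code lists the turns from its owner bottom-up.  The gadget is the edge to child b of a root
-- followed by the six edges below that child, in the order of a path of the line graph.
gadget : Bool → List (List Bool)
gadget b = (L ∷ L ∷ b ∷ []) ∷ (R ∷ L ∷ b ∷ []) ∷ (L ∷ b ∷ []) ∷ (b ∷ [])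
         ∷ (R ∷ b ∷ []) ∷ (L ∷ R ∷ b ∷ []) ∷ (R ∷ R ∷ b ∷ []) ∷ []

gadget-path : ∀ b → Path CodeStep (gadget b)
gadget-path b =
  link ((λ ()) , siblings L R (L ∷ b ∷ [])) (link ((λ ()) , up L R (b ∷ [])) (link ((λ ()) , up b L [])
  (link ((λ ()) , down b R []) (link ((λ ()) , down R L (b ∷ [])) (link ((λ ()) , siblings L R (R ∷ b ∷ [])) (end _))))))

ownedPaths : Role → List (List (List Bool))
ownedPaths top   = ((L ∷ []) ∷ []) ∷ ((R ∷ []) ∷ []) ∷ []
ownedPaths root  = gadget L ∷ gadget R ∷ []
ownedPaths inner = []

ownedCodes : Role → List (List Bool)
ownedCodes ρ = concat (ownedPaths ρ)

pathCount : Role → ℕ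
pathCount top   = 2
pathCount root  = 2
pathCount inner = 0

length-ownedPaths : ∀ ρ → length (ownedPaths ρ) ≡ pathCount ρ
length-ownedPaths top   = refl
length-ownedPaths root  = refl
length-ownedPaths inner = refl

ownedPaths-path : ∀ ρ → All (Path CodeStep) (ownedPaths ρ)
ownedPaths-path top   = end _ ∷ end _ ∷ []
ownedPaths-path root  = gadget-path L ∷ gadget-path R ∷ []
ownedPaths-path inner = []

ownedCodes-unique : ∀ ρ → Unique (ownedCodes ρ)
ownedCodes-unique top   = from-yes (unique? (ownedCodes top))
ownedCodes-unique root  = from-yes (unique? (ownedCodes root))
ownedCodes-unique inner = []

ownedCodes-length : ∀ ρ → All (λ c → 1 ≤ length c × length c ≤ 3) (ownedCodes ρ)
ownedCodes-length top   = from-yes (all? (λ c → 1 ≤? length c ×-dec length c ≤? 3) (ownedCodes top))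
ownedCodes-length root  = from-yes (all? (λ c → 1 ≤? length c ×-dec length c ≤? 3) (ownedCodes root))
ownedCodes-length inner = []

ownedCodes-top-length : All (λ c → length c ≡ 1) (ownedCodes top)
ownedCodes-top-length = refl ∷ refl ∷ []

∈-ownedCodes-top : ∀ b → (b ∷ []) ∈ ownedCodes top
∈-ownedCodes-top L = here refl
∈-ownedCodes-top R = there (here refl)

∈-ownedCodes-root : ∀ c → 1 ≤ length c → length c ≤ 3 → c ∈ ownedCodes root
∈-ownedCodes-root c@(L ∷ [])         _ _ = from-yes (c ∈ᶜ? ownedCodes root)
∈-ownedCodes-root c@(R ∷ [])         _ _ = from-yes (c ∈ᶜ? ownedCodes root)
∈-ownedCodes-root c@(L ∷ L ∷ [])     _ _ = from-yes (c ∈ᶜ? ownedCodes root)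
∈-ownedCodes-root c@(L ∷ R ∷ [])     _ _ = from-yes (c ∈ᶜ? ownedCodes root)
∈-ownedCodes-root c@(R ∷ L ∷ [])     _ _ = from-yes (c ∈ᶜ? ownedCodes root)
∈-ownedCodes-root c@(R ∷ R ∷ [])     _ _ = from-yes (c ∈ᶜ? ownedCodes root)
∈-ownedCodes-root c@(L ∷ L ∷ L ∷ []) _ _ = from-yes (c ∈ᶜ? ownedCodes root)
∈-ownedCodes-root c@(L ∷ L ∷ R ∷ []) _ _ = from-yes (c ∈ᶜ? ownedCodes root)
∈-ownedCodes-root c@(L ∷ R ∷ L ∷ []) _ _ = from-yes (c ∈ᶜ? ownedCodes root)
∈-ownedCodes-root c@(L ∷ R ∷ R ∷ []) _ _ = from-yes (c ∈ᶜ? ownedCodes root)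
∈-ownedCodes-root c@(R ∷ L ∷ L ∷ []) _ _ = from-yes (c ∈ᶜ? ownedCodes root)
∈-ownedCodes-root c@(R ∷ L ∷ R ∷ []) _ _ = from-yes (c ∈ᶜ? ownedCodes root)
∈-ownedCodes-root c@(R ∷ R ∷ L ∷ []) _ _ = from-yes (c ∈ᶜ? ownedCodes root)
∈-ownedCodes-root c@(R ∷ R ∷ R ∷ []) _ _ = from-yes (c ∈ᶜ? ownedCodes root)
∈-ownedCodes-root (_ ∷ _ ∷ _ ∷ _ ∷ _) _ (s≤s (s≤s (s≤s ())))

codeEdge : ℕ → List Bool → Edge
codeEdge y []       = (y , y)  -- junk: owned codes are nonempty
codeEdge y (b ∷ bs) = (descend bs y , descend (b ∷ bs) y)

codeEdge-lower : ∀ y c → proj₂ (codeEdge y c) ≡ descend c y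
codeEdge-lower y []      = refl
codeEdge-lower y (_ ∷ _) = refl

codeEdge-injective : ∀ y {c c′} → codeEdge y c ≡ codeEdge y c′ → c ≡ c′
codeEdge-injective y {c} {c′} e =
  descend-injective y (trans (sym (codeEdge-lower y c)) (trans (cong proj₂ e) (codeEdge-lower y c′)))

EdgeStep : Edge → Edge → Set
EdgeStep e f = e ≢ f × ShareEnd e f

codeStep⇒edgeStep : ∀ y {c c′} → CodeStep c c′ → EdgeStep (codeEdge y c) (codeEdge y c′)
codeStep⇒edgeStep y (c≢c′ , adj) = c≢c′ ∘ codeEdge-injective y , shareEnd adj
  where
  shareEnd : ∀ {c c′} → Adjacent c c′ → ShareEnd (codeEdge y c) (codeEdge y c′)
  shareEnd (siblings _ _ _) = inj₁ refl
  shareEnd (down _ _ _)     = inj₂ (inj₂ (inj₁ refl))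
  shareEnd (up _ _ _)       = inj₂ (inj₁ refl)

Unique-concatMap : ∀ {A B : Set} (K : A → List B) (label : B → A) {xs} → Unique xs →
  (∀ x → Unique (K x)) → (∀ {x b} → b ∈ K x → label b ≡ x) → Unique (concatMap K xs)
Unique-concatMap K label {[]}     []              K! labelled = []
Unique-concatMap K label {x ∷ xs} (x∉xs ∷ xs!) K! labelled =
  ++⁺ (K! x) (Unique-concatMap K label xs! K! labelled) disjoint
  where
  disjoint : ∀ {b} → ¬ (b ∈ K x × b ∈ concatMap K xs)
  disjoint (b∈Kx , b∈rest) with ∈-concat⁻′ (map K xs) b∈rest
  ... | _ , b∈Kx′ , Kx′∈ with ∈-map⁻ K Kx′∈
  ...   | x′ , x′∈xs , refl = All.lookup x∉xs x′∈xs (trans (sym (labelled b∈Kx)) (labelled b∈Kx′))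

module Ownership (r : ℕ) where

  roleOf : ℕ → Role
  roleOf y = roleAt r (depth y)

  ownedEdges : ℕ → List Edge
  ownedEdges y = map (codeEdge y) (ownedCodes (roleOf y))

  ownedEdgePaths : ℕ → List (List Edge)
  ownedEdgePaths y = map (map (codeEdge y)) (ownedPaths (roleOf y))

  edgePathsUpTo : ℕ → List (List Edge)
  edgePathsUpTo n = concatMap ownedEdgePaths (upTo n)

  edgesUpTo : ℕ → List Edge
  edgesUpTo n = concatMap ownedEdges (upTo n)

  concat-edgePathsUpTo : ∀ n → concat (edgePathsUpTo n) ≡ edgesUpTo n
  concat-edgePathsUpTo n = trans (sym (concat-concat (map ownedEdgePaths (upTo n))))
    (cong concat (trans (sym (map-∘ (upTo n))) (map-cong (λ y → concat-map (ownedPaths (roleOf y))) (upTo n))))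

  edgePathsUpTo-path : ∀ n → All (Path EdgeStep) (edgePathsUpTo n)
  edgePathsUpTo-path n = All.concat⁺ (All.map⁺ (All.universal ownedEdgePaths-path (upTo n)))
    where
    ownedEdgePaths-path : ∀ y → All (Path EdgeStep) (ownedEdgePaths y)
    ownedEdgePaths-path y = All.map⁺ (All.map (Path-map (codeEdge y) (codeStep⇒edgeStep y)) (ownedPaths-path (roleOf y)))

  owner : ℕ → ℕ
  owner v = ancestor (ownerDistance r (depth v)) v

  owner-descend : ∀ y c → c ∈ ownedCodes (roleOf y) → owner (descend c y) ≡ y
  owner-descend y c c∈ = trans (cong (λ t → ancestor t (descend c y)) distance) (ancestor-descend c y)
    where
    distance-by-role : ∀ ρ → roleOf y ≡ ρ → c ∈ ownedCodes ρ → ownerDistance r (length c + depth y) ≡ length c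
    distance-by-role top e c∈′ rewrite All.lookup ownedCodes-top-length c∈′ =
      trans (cong (ownerDistance r) (+-comm 1 (depth y))) (ownerDistance-top+1 r (depth y) e)
    distance-by-role root e c∈′ with All.lookup (ownedCodes-length root) c∈′
    ... | 1≤c , c≤3 = trans (cong (ownerDistance r) (+-comm (length c) (depth y))) (ownerDistance-root+ r (depth y) (length c) e 1≤c c≤3)
    distance : ownerDistance r (depth (descend c y)) ≡ length c
    distance = trans (cong (ownerDistance r) (depth-descend c y)) (distance-by-role (roleOf y) refl c∈)

  edgesUpTo-unique : ∀ n → Unique (edgesUpTo n)
  edgesUpTo-unique n = Unique-concatMap ownedEdges (owner ∘ proj₂) (upTo⁺ n)
    (λ y → map⁺ (codeEdge-injective y) (ownedCodes-unique (roleOf y))) labelled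
    where
    labelled : ∀ {y e} → e ∈ ownedEdges y → owner (proj₂ e) ≡ y
    labelled {y} e∈ with ∈-map⁻ (codeEdge y) e∈
    ... | c , c∈ , refl = trans (cong owner (codeEdge-lower y c)) (owner-descend y c c∈)

module _ (F : List Edge) where
  private
    f : Fin (length F) → Edge
    f = lookup F

  map-++-split : ∀ xs ys zs → xs ++ ys ≡ map f zs →
    Σ (List (Fin (length F))) λ zs₁ → Σ (List (Fin (length F))) λ zs₂ → zs ≡ zs₁ ++ zs₂ × xs ≡ map f zs₁ × ys ≡ map f zs₂
  map-++-split []       ys zs       e = [] , zs , refl , refl , e
  map-++-split (x ∷ xs) ys (z ∷ zs) e with ∷-injective e
  ... | x≡ , e′ with map-++-split xs ys zs e′
  ...   | zs₁ , zs₂ , refl , refl , refl = z ∷ zs₁ , zs₂ , refl , cong (_∷ _) x≡ , refl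

  map-concat-split : ∀ ws zs → concat ws ≡ map f zs →
    Σ (List (List (Fin (length F)))) λ ps → concat ps ≡ zs × map (map f) ps ≡ ws
  map-concat-split []       []       _ = [] , refl , refl
  map-concat-split (w ∷ ws) zs       e with map-++-split w (concat ws) zs e
  ... | zs₁ , zs₂ , refl , refl , e′ with map-concat-split ws zs₂ e′
  ...   | ps , refl , refl = zs₁ ∷ ps , refl , refl

  edgePath⇒walk : ∀ p → Path EdgeStep (map f p) → Walk (LineAdj F) p
  edgePath⇒walk (i ∷ [])     (end _)                   = single i
  edgePath⇒walk (i ∷ j ∷ is) (link (e≢f , share) rest) = step i j is ((λ i≡j → e≢f (cong f i≡j)) , share) (edgePath⇒walk (j ∷ is) rest)

  edgePaths⇒pathCover : ∀ ws → All (Path EdgeStep) ws → concat ws ↭ F → HasPathCover (LineAdj F) (length ws)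
  edgePaths⇒pathCover ws ws-paths ws↭F
    with ↭-map-inv f (subst (_↭ concat ws) (sym F≡) (↭-sym ws↭F))
    where
    F≡ : map f (allFin (length F)) ≡ F
    F≡ = trans (map-tabulate (λ i → i) f) (tabulate-lookup F)
  ... | zs , ws≡ , allFin↭zs with map-concat-split ws zs ws≡
  ...   | ps , refl , refl = ps , sym (length-map (map f) ps) ,
          All.tabulate (λ {p} p∈ → edgePath⇒walk p (All.lookup (All.map⁻ ws-paths) p∈)) , ↭-sym allFin↭zs

parentEdge∈BEdges : ∀ d b x → depth (child b x) ≤ d → (x , child b x) ∈ BEdges d
parentEdge∈BEdges d b x depth≤ = subst (_∈ BEdges d) (treeEdge-downEdge b) (∈-applyUpTo⁺ treeEdge (+-cancelʳ-< 2 _ _ (begin-strict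
  downEdge b x + 2        ≡⟨ +-comm (downEdge b x) 2 ⟩
  suc (suc (downEdge b x)) ≡⟨ cong suc (suc-downEdge b) ⟩
  suc (child b x)         <⟨ depth<⇒suc<2^ (child b x) (suc d) (s≤s depth≤) ⟩
  2 ^ suc d               ≡⟨ sym (numV∸1+2 d) ⟩
  numV d ∸ 1 + 2          ∎)))
  where
  open ≤-Reasoning
  suc-downEdge : ∀ b → suc (downEdge b x) ≡ child b x
  suc-downEdge false = refl
  suc-downEdge true  = refl
  treeEdge-downEdge : ∀ b → treeEdge (downEdge b x) ≡ (x , child b x)
  treeEdge-downEdge b = cong₂ _,_ (trans (n/2≡⌊n/2⌋ (downEdge b x)) (trans (cong parent (suc-downEdge b)) (parent-child b x))) (suc-downEdge b)

<numV⇒depth≤ : ∀ d y → y < numV d → depth y ≤ d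
<numV⇒depth≤ d y y< = ≤-pred (suc<2^⇒depth< y (suc d) (pred< y< (m^n>0 2 (suc d))))
  where
  pred< : ∀ {y n} → y < n ∸ 1 → 0 < n → suc y < n
  pred< {n = suc n} y< _ = s≤s y<

module Construction (r q : ℕ) where
  open Ownership r

  d : ℕ
  d = r + (4 * q + 3)

  edges : List Edge
  edges = edgesUpTo (numV d)

  code-fits : ∀ {y c} → y < numV d → c ∈ ownedCodes (roleOf y) → length c + depth y ≤ d
  code-fits {y} {c} y< c∈ = by-role (roleOf y) refl c∈
    where
    by-role : ∀ ρ → roleOf y ≡ ρ → c ∈ ownedCodes ρ → length c + depth y ≤ d
    by-role top e c∈′ rewrite All.lookup ownedCodes-top-length c∈′ =
      ≤-trans (roleAt-top⇒< r (depth y) e) (m≤m+n r _)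
    by-role root e c∈′ = begin
      length c + depth y ≤⟨ +-monoˡ-≤ (depth y) (proj₂ (All.lookup (ownedCodes-length root) c∈′)) ⟩
      3 + depth y        ≡⟨ +-comm 3 (depth y) ⟩
      depth y + 3        ≤⟨ roleAt-root-bound r q (depth y) e (<numV⇒depth≤ d y y<) ⟩
      d                  ∎
      where open ≤-Reasoning

  edges⊆BEdges : ∀ {e} → e ∈ edges → e ∈ BEdges d
  edges⊆BEdges e∈ with ∈-concat⁻′ (map ownedEdges (upTo (numV d))) e∈
  ... | _ , e∈owned , owned∈ with ∈-map⁻ ownedEdges owned∈
  ... | y , y∈ , refl with ∈-map⁻ (codeEdge y) e∈owned
  ... | [] , c∈ , refl with () ← proj₁ (All.lookup (ownedCodes-length (roleOf y)) c∈)
  ... | b ∷ bs , c∈ , refl = parentEdge∈BEdges d b (descend bs y)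
        (≤-trans (≤-reflexive (depth-descend (b ∷ bs) y)) (code-fits (∈-upTo⁻ y∈) c∈))

  codeEdge∈edges : ∀ {y c} → y < numV d → c ∈ ownedCodes (roleOf y) → codeEdge y c ∈ edges
  codeEdge∈edges {y} y< c∈ = ∈-concat⁺′ (∈-map⁺ (codeEdge y) c∈) (∈-map⁺ ownedEdges (∈-upTo⁺ y<))

  Touches : ℕ → Edge → Set
  Touches v e = v ≡ proj₁ e ⊎ v ≡ proj₂ e

  incident-edge : ∀ v → v < numV d → Σ Edge λ e → e ∈ edges × Touches v e
  incident-edge v v< = by-role (roleOf v) refl
    where
    by-role : ∀ ρ → roleOf v ≡ ρ → Σ Edge λ e → e ∈ edges × Touches v e
    by-role top e =
      codeEdge v (L ∷ []) , codeEdge∈edges v< (subst (λ ρ → (L ∷ []) ∈ ownedCodes ρ) (sym e) (∈-ownedCodes-top L)) , inj₁ refl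
    by-role root e =
      codeEdge v (L ∷ []) ,
      codeEdge∈edges v< (subst (λ ρ → (L ∷ []) ∈ ownedCodes ρ) (sym e) (∈-ownedCodes-root (L ∷ []) (s≤s z≤n) (s≤s z≤n))) ,
      inj₁ refl
    by-role inner e with roleAt-inner r (depth v) e
    ... | t , 1≤t , t≤3 , t≤depth , root-above with descend-ancestor t v t≤depth
    ... | bs , refl , v≡ = codeEdge y bs , codeEdge∈edges (≤-<-trans (ancestor≤ t v) v<) bs∈ , inj₂ (trans (sym v≡) (sym (codeEdge-lower y bs)))
      where
      y = ancestor t v
      y-root : roleOf y ≡ root
      y-root = trans (cong (roleAt r) (trans (sym (m+n∸n≡m (depth y) t)) (cong (_∸ t) (depth-ancestor t v t≤depth)))) root-above
      bs∈ : bs ∈ ownedCodes (roleOf y)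
      bs∈ = subst (λ ρ → bs ∈ ownedCodes ρ) (sym y-root) (∈-ownedCodes-root bs 1≤t t≤3)

  -- Filtering BEdges d keeps the edges in its order, so the subgraph is a sublist of it.
  subgraph : List Edge
  subgraph = filter (_∈ᵉ? edges) (BEdges d)

  edges↭subgraph : edges ↭ subgraph
  edges↭subgraph = ∼bag⇒↭ (unique∧set⇒bag (edgesUpTo-unique (numV d)) (filter⁺ (_∈ᵉ? edges) BEdges!)
    (mk⇔ (λ e∈ → ∈-filter⁺ (_∈ᵉ? edges) (edges⊆BEdges e∈) e∈) (λ e∈ → proj₂ (∈-filter⁻ (_∈ᵉ? edges) {xs = BEdges d} e∈))))
    where
    BEdges! : Unique (BEdges d)
    BEdges! = applyUpTo⁺₁ treeEdge (numV d ∸ 1) (λ i<j _ e → <⇒≢ i<j (suc-injective (cong proj₂ e)))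

  subgraph-spanning : SpanNoIso d subgraph
  subgraph-spanning = filter-⊆ (_∈ᵉ? edges) (BEdges d) , λ v v< → touched (incident-edge v v<)
    where
    touched : ∀ {v} → Σ Edge (λ e → e ∈ edges × Touches v e) → Any (Touches v) subgraph
    touched {v} (e , e∈ , touches) = Any.map (λ e≡ → subst (Touches v) e≡ touches) (∈-filter⁺ (_∈ᵉ? edges) (edges⊆BEdges e∈) e∈)

  subgraph-pathCover : HasPathCover (LineAdj subgraph) (length (edgePathsUpTo (numV d)))
  subgraph-pathCover = edgePaths⇒pathCover subgraph (edgePathsUpTo (numV d)) (edgePathsUpTo-path (numV d))
    (subst (_↭ subgraph) (sym (concat-edgePathsUpTo (numV d))) edges↭subgraph)

-- Counting the paths of the construction

Σ< : ℕ → (ℕ → ℕ) → ℕ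
Σ< zero    h = 0
Σ< (suc n) h = Σ< n h + h n

length-concatMap-upTo : ∀ {B : Set} (K : ℕ → List B) n → length (concatMap K (upTo n)) ≡ Σ< n (length ∘ K)
length-concatMap-upTo K zero    = refl
length-concatMap-upTo K (suc n) = begin
  length (concatMap K (upTo (suc n)))          ≡⟨ cong (length ∘ concatMap K) (sym (upTo-∷ʳ n)) ⟩
  length (concatMap K (upTo n ++ [ n ]))       ≡⟨ cong length (concatMap-++ K (upTo n) [ n ]) ⟩
  length (concatMap K (upTo n) ++ K n ++ [])   ≡⟨ length-++ (concatMap K (upTo n)) ⟩
  length (concatMap K (upTo n)) + length (K n ++ []) ≡⟨ cong₂ _+_ (length-concatMap-upTo K n) (cong length (++-identityʳ (K n))) ⟩
  Σ< n (length ∘ K) + length (K n) ∎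
  where
  open ≡-Reasoning
  open import Data.List.Properties using (++-identityʳ)

Σ<-+ : ∀ a b h → Σ< (a + b) h ≡ Σ< a h + Σ< b (h ∘ (a +_))
Σ<-+ a zero    h = trans (cong (λ n → Σ< n h) (+-identityʳ a)) (sym (+-identityʳ _))
Σ<-+ a (suc b) h = trans (cong (λ n → Σ< n h) (+-suc a b)) (trans (cong (_+ h (a + b)) (Σ<-+ a b h)) (+-assoc (Σ< a h) _ _))

Σ<-const : ∀ b h {k} → (∀ {o} → o < b → h o ≡ k) → Σ< b h ≡ b * k
Σ<-const zero    h _     = refl
Σ<-const (suc b) h {k} h≡k = trans (cong₂ _+_ (Σ<-const b h (h≡k ∘ m≤n⇒m≤1+n)) (h≡k ≤-refl)) (+-comm (b * k) k)

levelSum : ℕ → (ℕ → ℕ) → ℕ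
levelSum zero    g = 0
levelSum (suc m) g = levelSum m g + 2 ^ m * g m

depth-level : ∀ D o → o < 2 ^ D → depth (2 ^ D ∸ 1 + o) ≡ D
depth-level D o o< = ≤-antisym (≤-pred (suc<2^⇒depth< _ (suc D) upper)) (2^≤⇒≤depth _ D lower)
  where
  suc-level : suc (2 ^ D ∸ 1 + o) ≡ 2 ^ D + o
  suc-level = cong (_+ o) (suc-pred (2 ^ D) {{>-nonZero (m^n>0 2 D)}})
  upper : suc (2 ^ D ∸ 1 + o) < 2 ^ suc D
  upper = begin-strict
    suc (2 ^ D ∸ 1 + o) ≡⟨ suc-level ⟩
    2 ^ D + o           <⟨ +-monoʳ-< (2 ^ D) o< ⟩
    2 ^ D + 2 ^ D       ≡⟨ cong (2 ^ D +_) (sym (+-identityʳ (2 ^ D))) ⟩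
    2 ^ suc D           ∎
    where open ≤-Reasoning
  lower : 2 ^ D ≤ suc (2 ^ D ∸ 1 + o)
  lower = ≤-trans (m≤m+n (2 ^ D) o) (≤-reflexive (sym suc-level))

Σ<-levels : ∀ m g → Σ< (2 ^ m ∸ 1) (g ∘ depth) ≡ levelSum m g
Σ<-levels zero    g = refl
Σ<-levels (suc m) g = begin
  Σ< (2 ^ suc m ∸ 1) (g ∘ depth)                               ≡⟨ cong (λ n → Σ< n (g ∘ depth)) split ⟩
  Σ< (2 ^ m ∸ 1 + 2 ^ m) (g ∘ depth)                           ≡⟨ Σ<-+ (2 ^ m ∸ 1) (2 ^ m) (g ∘ depth) ⟩
  Σ< (2 ^ m ∸ 1) (g ∘ depth) + Σ< (2 ^ m) (g ∘ depth ∘ (2 ^ m ∸ 1 +_))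
    ≡⟨ cong₂ _+_ (Σ<-levels m g) (Σ<-const (2 ^ m) _ (cong g ∘ depth-level m _)) ⟩
  levelSum m g + 2 ^ m * g m                                   ∎
  where
  open ≡-Reasoning
  split : 2 ^ suc m ∸ 1 ≡ 2 ^ m ∸ 1 + 2 ^ m
  split = go (2 ^ m) (m^n>0 2 m)
    where
    go : ∀ a → 0 < a → 2 * a ∸ 1 ≡ a ∸ 1 + a
    go (suc a) _ = cong (λ n → a + suc n) (+-identityʳ a)

Σ<-cong : ∀ n {h h′} → (∀ i → h i ≡ h′ i) → Σ< n h ≡ Σ< n h′
Σ<-cong zero    _   = refl
Σ<-cong (suc n) h≗h′ = cong₂ _+_ (Σ<-cong n h≗h′) (h≗h′ n)

levelSum-cong : ∀ n {g g′} → (∀ D → g D ≡ g′ D) → levelSum n g ≡ levelSum n g′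
levelSum-cong zero    _    = refl
levelSum-cong (suc n) g≗g′ = cong₂ (λ s t → s + 2 ^ n * t) (levelSum-cong n g≗g′) (g≗g′ n)

levelSum-+ : ∀ a b g → levelSum (a + b) g ≡ levelSum a g + 2 ^ a * levelSum b (g ∘ (a +_))
levelSum-+ a zero    g = trans (cong (λ n → levelSum n g) (+-identityʳ a)) (sym (trans (cong (levelSum a g +_) (*-zeroʳ (2 ^ a))) (+-identityʳ _)))
levelSum-+ a (suc b) g = begin
  levelSum (a + suc b) g                                        ≡⟨ cong (λ n → levelSum n g) (+-suc a b) ⟩
  levelSum (a + b) g + 2 ^ (a + b) * g (a + b)                  ≡⟨ cong₂ (λ s t → s + t * g (a + b)) (levelSum-+ a b g) (^-distribˡ-+-* 2 a b) ⟩
  levelSum a g + 2 ^ a * levelSum b (g ∘ (a +_)) + 2 ^ a * 2 ^ b * g (a + b)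
                                                                ≡⟨ regroup (levelSum a g) (2 ^ a) (levelSum b (g ∘ (a +_))) (2 ^ b) (g (a + b)) ⟩
  levelSum a g + 2 ^ a * (levelSum b (g ∘ (a +_)) + 2 ^ b * g (a + b)) ∎
  where
  open ≡-Reasoning
  regroup : ∀ s p t q x → s + p * t + p * q * x ≡ s + p * (t + q * x)
  regroup = solve-∀

levelSum-2 : ∀ n g → (∀ {D} → D < n → g D ≡ 2) → levelSum n g + 2 ≡ 2 * 2 ^ n
levelSum-2 zero    g _   = refl
levelSum-2 (suc n) g g≡2 = begin
  levelSum n g + 2 ^ n * g n + 2 ≡⟨ cong (λ t → levelSum n g + 2 ^ n * t + 2) (g≡2 ≤-refl) ⟩
  levelSum n g + 2 ^ n * 2 + 2   ≡⟨ regroup (levelSum n g) (2 ^ n) ⟩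
  (levelSum n g + 2) + 2 * 2 ^ n ≡⟨ cong (_+ 2 * 2 ^ n) (levelSum-2 n g (g≡2 ∘ m≤n⇒m≤1+n)) ⟩
  2 * 2 ^ n + 2 * 2 ^ n          ≡⟨ double (2 ^ n) ⟩
  2 * 2 ^ suc n                  ∎
  where
  open ≡-Reasoning
  regroup : ∀ s p → s + p * 2 + 2 ≡ (s + 2) + 2 * p
  regroup = solve-∀
  double : ∀ p → 2 * p + 2 * p ≡ 2 * (2 * p)
  double = solve-∀

cycleRole-periodic : ∀ k j → cycleRole (4 * k + j) ≡ cycleRole j
cycleRole-periodic zero    j = refl
cycleRole-periodic (suc k) j = trans (cong (λ n → cycleRole (n + j)) (*-suc 4 k)) (cycleRole-periodic k j)

levelSum-cycle : ∀ k → 15 * levelSum (4 * k) (pathCount ∘ cycleRole) + 2 ≡ 2 * 16 ^ k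
levelSum-cycle zero    = refl
levelSum-cycle (suc k) = begin
  15 * levelSum (4 * suc k) g + 2
    ≡⟨ cong (λ n → 15 * levelSum n g + 2) (trans (*-suc 4 k) (+-comm 4 (4 * k))) ⟩
  15 * levelSum (4 * k + 4) g + 2
    ≡⟨ cong (λ n → 15 * n + 2) (levelSum-+ (4 * k) 4 g) ⟩
  15 * (levelSum (4 * k) g + 2 ^ (4 * k) * levelSum 4 (g ∘ (4 * k +_))) + 2
    ≡⟨ cong (λ n → 15 * (levelSum (4 * k) g + 2 ^ (4 * k) * n) + 2) (levelSum-cong 4 (cong pathCount ∘ cycleRole-periodic k)) ⟩
  15 * (levelSum (4 * k) g + 2 ^ (4 * k) * 2) + 2
    ≡⟨ regroup (levelSum (4 * k) g) (2 ^ (4 * k)) ⟩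
  (15 * levelSum (4 * k) g + 2) + 30 * 2 ^ (4 * k)
    ≡⟨ cong₂ (λ s t → s + 30 * t) (levelSum-cycle k) (sym (^-*-assoc 2 4 k)) ⟩
  2 * 16 ^ k + 30 * 16 ^ k
    ≡⟨ sixteenfold (16 ^ k) ⟩
  2 * 16 ^ suc k ∎
  where
  open ≡-Reasoning
  g = pathCount ∘ cycleRole
  regroup : ∀ s p → 15 * (s + p * 2) + 2 ≡ (15 * s + 2) + 30 * p
  regroup = solve-∀
  sixteenfold : ∀ p → 2 * p + 30 * p ≡ 2 * (16 * p)
  sixteenfold = solve-∀

edgePathCount-bound : ∀ r q → r ≤ 3 →
  15 * length (Ownership.edgePathsUpTo r (numV (r + (4 * q + 3)))) ≤ 2 * 2 ^ suc (r + (4 * q + 3)) + 194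
edgePathCount-bound r q r≤3 = +-cancelʳ-≤ (30 + 2 * A) _ _ (begin
  15 * W + (30 + 2 * A)                      ≡⟨ key ⟩
  2 * T + 30 * A                             ≡⟨ regroup T A ⟩
  2 * T + 2 * A + 28 * A                     ≤⟨ +-monoʳ-≤ (2 * T + 2 * A) (*-monoʳ-≤ 28 (^-monoʳ-≤ 2 r≤3)) ⟩
  2 * T + 2 * A + 28 * 8                     ≡⟨ regroup′ T A ⟩
  2 * T + 194 + (30 + 2 * A)                 ∎)
  where
  open ≤-Reasoning
  open Ownership r
  d = r + (4 * q + 3)
  g = pathCount ∘ roleAt r
  A = 2 ^ r
  T = 2 ^ suc d
  Top = levelSum r g
  V = levelSum (4 * suc q) (pathCount ∘ cycleRole)
  W = length (edgePathsUpTo (numV d))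
  suc-d : suc d ≡ r + 4 * suc q
  suc-d = regroup-depth r q
    where
    regroup-depth : ∀ r q → suc (r + (4 * q + 3)) ≡ r + 4 * suc q
    regroup-depth = solve-∀
  W≡ : W ≡ Top + A * V
  W≡ = begin-equality
    W                                           ≡⟨ length-concatMap-upTo ownedEdgePaths (numV d) ⟩
    Σ< (numV d) (length ∘ ownedEdgePaths)       ≡⟨ Σ<-cong (numV d) (λ y → trans (length-map _ (ownedPaths (roleOf y))) (length-ownedPaths (roleOf y))) ⟩
    Σ< (2 ^ suc d ∸ 1) (g ∘ depth)              ≡⟨ Σ<-levels (suc d) g ⟩
    levelSum (suc d) g                          ≡⟨ cong (λ n → levelSum n g) suc-d ⟩
    levelSum (r + 4 * suc q) g                  ≡⟨ levelSum-+ r (4 * suc q) g ⟩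
    Top + A * levelSum (4 * suc q) (g ∘ (r +_)) ≡⟨ cong (λ n → Top + A * n) (levelSum-cong (4 * suc q) (cong pathCount ∘ roleAt-shift r)) ⟩
    Top + A * V                                 ∎
  T≡ : T ≡ A * 16 ^ suc q
  T≡ = trans (cong (2 ^_) suc-d) (trans (^-distribˡ-+-* 2 r (4 * suc q)) (cong (A *_) (sym (^-*-assoc 2 4 (suc q)))))
  key : 15 * W + (30 + 2 * A) ≡ 2 * T + 30 * A
  key = begin-equality
    15 * W + (30 + 2 * A)                     ≡⟨ cong (λ n → 15 * n + (30 + 2 * A)) W≡ ⟩
    15 * (Top + A * V) + (30 + 2 * A)         ≡⟨ expand Top A V ⟩
    15 * (Top + 2) + A * (15 * V + 2)         ≡⟨ cong₂ (λ s t → 15 * s + A * t) (levelSum-2 r g (cong pathCount ∘ <⇒roleAt-top r _)) (levelSum-cycle (suc q)) ⟩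
    15 * (2 * A) + A * (2 * 16 ^ suc q)       ≡⟨ collect A (16 ^ suc q) ⟩
    2 * (A * 16 ^ suc q) + 30 * A             ≡⟨ cong (λ n → 2 * n + 30 * A) (sym T≡) ⟩
    2 * T + 30 * A                            ∎
    where
    expand : ∀ t a v → 15 * (t + a * v) + (30 + 2 * a) ≡ 15 * (t + 2) + a * (15 * v + 2)
    expand = solve-∀
    collect : ∀ a s → 15 * (2 * a) + a * (2 * s) ≡ 2 * (a * s) + 30 * a
    collect = solve-∀
  regroup : ∀ t a → 2 * t + 30 * a ≡ 2 * t + 2 * a + 28 * a
  regroup = solve-∀
  regroup′ : ∀ t a → 2 * t + 2 * a + 28 * 8 ≡ 2 * t + 194 + (30 + 2 * a)
  regroup′ = solve-∀

¬¬-least : ∀ (P : ℕ → Set) {n} → P n → ¬ ¬ Σ ℕ (IsMin P)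
¬¬-least P {n} Pn no-least = <-rec (λ n → ¬ P n) none-least n Pn
  where
  none-least : ∀ n → (∀ {k} → k < n → ¬ P k) → ¬ P n
  none-least n below Pn = no-least (n , Pn , least)
    where
    least : ∀ k → P k → n ≤ k
    least k Pk with n ≤? k
    ... | yes n≤k = n≤k
    ... | no  n≰k = ⊥-elim (below (≰⇒> n≰k) Pk)

singletons-pathCover : ∀ {m} (Adj : Fin m → Fin m → Set) → HasPathCover Adj m
singletons-pathCover {m} Adj =
  map [_] (allFin m) , trans (length-map [_] (allFin m)) (length-tabulate (λ i → i)) ,
  All.tabulate (λ p∈ → walk (∈-map⁻ [_] p∈)) , ↭-reflexive (concat-map-[_] (allFin m))
  where
  walk : ∀ {p} → Σ (Fin m) (λ i → i ∈ allFin m × p ≡ [ i ]) → Walk Adj p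
  walk (i , _ , refl) = single i

depth-decomposition : ∀ d → 3 ≤ d → Σ ℕ λ r → Σ ℕ λ q → r ≤ 3 × d ≡ r + (4 * q + 3)
depth-decomposition d 3≤d = e % 4 , e / 4 , ≤-pred (m%n<n e 4) , d≡
  where
  e = d ∸ 3
  d≡ : d ≡ e % 4 + (4 * (e / 4) + 3)
  d≡ = trans (sym (m∸n+n≡m 3≤d)) (trans (cong (_+ 3) (m≡m%n+[m/n]*n e 4)) (regroup (e % 4) (e / 4)))
    where
    regroup : ∀ a b → a + b * 4 + 3 ≡ a + (4 * b + 3)
    regroup = solve-∀

p-upperBound : ∀ d p → 3 ≤ d → IsP d p → 15 * p ≤ 2 * 2 ^ suc d + 194
p-upperBound d p 3≤d (_ , p-least) with depth-decomposition d 3≤d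
... | r , q , r≤3 , refl = ≤-trans (*-monoʳ-≤ 15 p≤paths) (edgePathCount-bound r q r≤3)
  where
  open Construction r q using (subgraph; subgraph-spanning; subgraph-pathCover)
  paths = length (Ownership.edgePathsUpTo r (numV d))
  -- The least cover of L(subgraph) is not computable, but ¬¬ suffices for the decidable p ≤ paths.
  p≤paths : p ≤ paths
  p≤paths = decidable-stable (p ≤? paths) λ p≰ →
    ¬¬-least (HasPathCover (LineAdj subgraph)) subgraph-pathCover λ { (k , pcn) →
      p≰ (≤-trans (p-least k (subgraph , subgraph-spanning , pcn)) (proj₂ pcn paths subgraph-pathCover)) }

gap-arithmetic : ∀ T g p → 7 * T ≤ 50 * g + 164 → 15 * p ≤ 2 * T + 194 → 8192 ≤ T → T ∸ 1 + 300 * p ≤ 300 * g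
gap-arithmetic T g p g-bound p-bound T-large = +-cancelʳ-≤ 984 _ _ (begin
  T ∸ 1 + 300 * p + 984         ≤⟨ +-monoˡ-≤ 984 (+-mono-≤ (m∸n≤m T 1) (≤-reflexive (twentyfold p))) ⟩
  T + 20 * (15 * p) + 984       ≤⟨ +-monoˡ-≤ 984 (+-monoʳ-≤ T (*-monoʳ-≤ 20 p-bound)) ⟩
  T + 20 * (2 * T + 194) + 984  ≡⟨ expand T ⟩
  41 * T + 4864                 ≤⟨ +-monoʳ-≤ (41 * T) (≤-trans (≤ᵇ⇒≤ 4864 8192 _) T-large) ⟩
  41 * T + T                    ≡⟨ sixfold T ⟩
  6 * (7 * T)                   ≤⟨ *-monoʳ-≤ 6 g-bound ⟩
  6 * (50 * g + 164)            ≡⟨ distribute g ⟩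
  300 * g + 984                 ∎)
  where
  open ≤-Reasoning
  twentyfold : ∀ p → 300 * p ≡ 20 * (15 * p)
  twentyfold = solve-∀
  expand : ∀ T → T + 20 * (2 * T + 194) + 984 ≡ 41 * T + 4864
  expand = solve-∀
  sixfold : ∀ T → 41 * T + T ≡ 6 * (7 * T)
  sixfold = solve-∀
  distribute : ∀ g → 6 * (50 * g + 164) ≡ 300 * g + 984
  distribute = solve-∀

g≤numV : ∀ d g → IsG d g → g ≤ numV d
g≤numV d g (_ , g-least) = begin
  g                  ≤⟨ g-least _ (singletons-pathCover _) ⟩
  length (BEdges d)  ≡⟨ length-applyUpTo _ (numV d ∸ 1) ⟩
  numV d ∸ 1         ≤⟨ m∸n≤m (numV d) 1 ⟩
  numV d             ∎
  where open ≤-Reasoning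

theorem7p7 : Σ ℕ λ k → Σ ℕ λ c₂ → Σ ℕ λ d₀ →
    (0 < k) × (0 < c₂) ×
    (∀ d → d₀ ≤ d → ∀ g p → IsG d g → IsP d p →
    (numV d + k * p ≤ k * g) × (g ≤ c₂ * numV d + p))
theorem7p7 = 300 , 1 , 12 , s≤s z≤n , s≤s z≤n , bounds
  where
  bounds : ∀ d → 12 ≤ d → ∀ g p → IsG d g → IsP d p → (numV d + 300 * p ≤ 300 * g) × (g ≤ 1 * numV d + p)
  bounds d@(suc h) 12≤d g p isG isP =
    gap-arithmetic (2 ^ suc d) g p
      (lineGraph-pathCover-lowerBound h g (proj₁ isG))
      (p-upperBound d p (≤-trans (s≤s (s≤s (s≤s z≤n))) 12≤d) isP)
      (^-monoʳ-≤ 2 {13} (s≤s 12≤d)) ,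
    ≤-trans (g≤numV d g isG) (≤-trans (≤-reflexive (sym (*-identityˡ (numV d)))) (m≤m+n _ p))
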